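{- Let $D$ be a loopless multigraph on the vertex set of $K_n$ with at most $2n-5$ edges, such that every vertex has degree at most $n-1$ in $D$. Then $D$ is realizable in $K_n$.
   Context: Given a simple graph $G$ and a multigraph $D$ with $V(D)=V(G)$, $D$ is realizable in $G$ if there exist pairwise edge-disjoint paths in $G$, one for each edge of $D$ (parallel edges counted separately), each joining the two endpoints of its edge. -}

module Defs where

open import Data.Nat using (ℕ; _≤_; _∸_; _*_)
open import Data.Fin using (Fin; _≟_)
open import Data.Product using (_×_; _,_; proj₁; proj₂)
open import Data.Sum using (_⊎_)
open import Data.List using (List; []; _∷_; length; lookup; filter)
open import Data.List.Relation.Unary.All using (All)
open import Data.List.Relation.Unary.Unique.Propositional using (Unique)
open import Data.List.Membership.Propositional using (_∈_)
open import Relation.Binary.PropositionalEquality using (_≡_; refl; sym)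
open import Relation.Nullary using (¬_)
open import Relation.Nullary.Decidable using (_⊎-dec_)

record SimpleGraph (n : ℕ) : Set₁ where
  field
    Adj    : Fin n → Fin n → Set
    symm   : ∀ {u v} → Adj u v → Adj v u
    irrefl : ∀ {u} → ¬ Adj u u

open SimpleGraph public

K : (n : ℕ) → SimpleGraph n
K n = record
  { Adj    = λ u v → ¬ u ≡ v
  ; symm   = λ p q → p (sym q)
  ; irrefl = λ p → p refl
  }

-- A multigraph D with V(D) = Fin n: a list of edges, each edge being a pair
-- of endpoints. Parallel edges are repeated list entries.
Multigraph : ℕ → Set
Multigraph n = List (Fin n × Fin n)

Loopless : ∀ {n} → Multigraph n → Set
Loopless D = All (λ e → ¬ proj₁ e ≡ proj₂ e) D

-- Degree of v in D: number of edges incident with v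
-- (in a loopless multigraph, each incident edge contributes 1).
degree : ∀ {n} → Multigraph n → Fin n → ℕ
degree D v = length (filter (λ e → (proj₁ e ≟ v) ⊎-dec (proj₂ e ≟ v)) D)

data Walk {n} (G : SimpleGraph n) : Fin n → Fin n → Set where
  [_]  : (u : Fin n) → Walk G u u
  _∷⟨_⟩_ : ∀ {v w} (u : Fin n) → Adj G u v → Walk G v w → Walk G u w

vertices : ∀ {n} {G : SimpleGraph n} {u v} → Walk G u v → List (Fin n)
vertices [ u ] = u ∷ []
vertices (u ∷⟨ _ ⟩ p) = u ∷ vertices p

edges : ∀ {n} {G : SimpleGraph n} {u v} → Walk G u v → List (Fin n × Fin n)
edges [ u ] = []
edges (_∷⟨_⟩_ {v} u _ p) = (u , v) ∷ edges p

IsPath : ∀ {n} {G : SimpleGraph n} {u v} → Walk G u v → Set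
IsPath p = Unique (vertices p)

record Path {n} (G : SimpleGraph n) (u v : Fin n) : Set where
  constructor mkPath
  field
    walk   : Walk G u v
    isPath : IsPath walk

open Path public

ShareEdge : ∀ {n} {G : SimpleGraph n} {a b c d} → Walk G a b → Walk G c d → Set
ShareEdge {n} p q = Data.Product.Σ (Fin n × Fin n) λ e →
  e ∈ edges p × ((e ∈ edges q) ⊎ ((proj₂ e , proj₁ e) ∈ edges q))

Realizable : ∀ {n} → SimpleGraph n → Multigraph n → Set
Realizable G D =
  Data.Product.Σ ((i : Fin (length D)) → Path G (proj₁ (lookup D i)) (proj₂ (lookup D i))) λ P →
    ∀ i j → ¬ i ≡ j → ¬ ShareEdge (walk (P i)) (walk (P j))

-- Induction on the number s of vertices, for demands with at most max(3, 2s − 5) edges and degrees at most s − 1,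
-- realized by paths inside a prescribed s-element vertex set. Let x be a vertex of maximum degree, with distinct
-- neighbours N and repeated demands E. If |D| ≤ |N| + bound (s − 1), delete x: a demand x–a with a ∈ N uses the
-- edge xa, and a repeated demand x–e becomes a demand w–e from a fresh vertex w, whose path is then prefixed by xw.
-- Otherwise the edge bound is tight and forces N = {a}; all edges at x or a then join x and a, and one deletes
-- instead a third vertex y, routing one demand x–a as x–y–a. Maximality of deg x keeps the degree bounds valid.

module Submission where

open import Defs
open import Data.Nat using (ℕ; zero; suc; _+_; _*_; _⊔_; _≤_; _<_; z≤n; s≤s; _∸_; _≤?_)
open import Data.Nat.Properties hiding (_≟_)
import Data.Nat.Tactic.RingSolver
open import Data.Fin using (Fin; _≟_)
import Data.Fin as Fin
open import Data.List using (List; []; _∷_; _++_; length; filter; map; take; lookup; allFin; concat; concatMap)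
open import Data.List.Properties using (filter-accept; filter-reject; filter-++; filter-all; filter-none; filter-some; length-filter; length-++; map-++; ∷-injective; ++-assoc; length-map; length-take; ++-identityʳ; length-tabulate; map-∘; concat-++)
open import Data.List.Membership.Propositional using (_∈_; _∉_; find)
open import Data.List.Membership.Propositional.Properties using (∈-++⁺ˡ; ∈-++⁺ʳ; ∈-++⁻; ∈-filter⁻; ∈-filter⁺; ∈-map⁻; ∈-map⁺; ∈-∃++; ∈-allFin)
open import Data.List.Relation.Unary.Any using (here; there)
import Data.List.Relation.Unary.Any as Any
open import Data.List.Relation.Unary.All using (All; []; _∷_)
import Data.List.Relation.Unary.All as All
import Data.List.Relation.Unary.All.Properties as AllP
open import Data.List.Relation.Unary.AllPairs using (AllPairs; []; _∷_)
open import Data.List.Relation.Unary.Unique.Propositional using (Unique)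
import Data.List.Relation.Unary.Unique.Propositional.Properties as UP
open import Data.List.Relation.Binary.Permutation.Propositional using (_↭_; ↭-refl; prep; ↭-sym; ↭-trans; ↭⇒↭ₛ; module PermutationReasoning)
open import Data.List.Relation.Binary.Disjoint.Propositional using (Disjoint)
open import Data.List.Relation.Binary.Permutation.Propositional.Properties using (filter-↭; ↭-length; All-resp-↭; ∈-resp-↭; ↭-map-inv; ∷↭∷ʳ; ++⁺ʳ; shift; shifts; ++-comm; ++⁺; map⁺)
import Data.List.Relation.Binary.Permutation.Setoid.Properties as ↭ₛ
open import Data.List.Relation.Binary.Pointwise using (Pointwise; []; _∷_)
open import Data.Product using (Σ; _×_; _,_; proj₁; proj₂; ∃; ∃₂; swap; uncurry)
open import Data.Sum using (_⊎_; inj₁; inj₂; [_,_]′)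
open import Data.Empty using (⊥; ⊥-elim)
open import Level using (Level)
open import Function using (_∘_; id)
open import Relation.Nullary using (¬_; yes; no; contradiction)
open import Relation.Nullary.Decidable using (_⊎-dec_)
open import Relation.Unary using (Pred; Decidable; ∁)
open import Relation.Unary.Properties using (∁?)
open import Relation.Binary.Definitions using (DecidableEquality)
open import Relation.Binary.PropositionalEquality using (_≡_; _≢_; refl; sym; trans; cong; cong₂; subst; subst₂; ≢-sym; resp₂; setoid; module ≡-Reasoning)

module _ {a ℓ : Level} {A : Set a} where

  count : {P : Pred A ℓ} → Decidable P → List A → ℕ
  count P? xs = length (filter P? xs)

  module _ {P : Pred A ℓ} (P? : Decidable P) where

    count-accept : ∀ {x} xs → P x → count P? (x ∷ xs) ≡ suc (count P? xs)
    count-accept xs px = cong length (filter-accept P? {xs = xs} px)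

    count-reject : ∀ {x} xs → ¬ P x → count P? (x ∷ xs) ≡ count P? xs
    count-reject xs ¬px = cong length (filter-reject P? {xs = xs} ¬px)

    count-++ : ∀ xs ys → count P? (xs ++ ys) ≡ count P? xs + count P? ys
    count-++ xs ys = trans (cong length (filter-++ P? xs ys)) (length-++ (filter P? xs))

    count-↭ : ∀ {xs ys} → xs ↭ ys → count P? xs ≡ count P? ys
    count-↭ p = ↭-length (filter-↭ P? p)

    count≤count-∷ : ∀ x xs → count P? xs ≤ count P? (x ∷ xs)
    count≤count-∷ x xs with P? x
    ... | yes _ = n≤1+n _
    ... | no _  = ≤-refl

    count-all : ∀ xs → All P xs → count P? xs ≡ length xs
    count-all xs all = cong length (filter-all P? all)

    count-none : ∀ xs → All (∁ P) xs → count P? xs ≡ 0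
    count-none xs none = cong length (filter-none P? none)

    count-∈ : ∀ {x} xs → x ∈ xs → P x → 1 ≤ count P? xs
    count-∈ xs x∈xs px = filter-some P? (Any.map (λ { refl → px }) x∈xs)

    count<length⇒∃∁ : ∀ xs → count P? xs < length xs → ∃ λ x → x ∈ xs × ¬ P x
    count<length⇒∃∁ xs lt = find (AllP.¬All⇒Any¬ P? xs (λ all → <⇒≢ lt (count-all xs all)))

    count>0⇒∃ : ∀ xs → 0 < count P? xs → ∃ λ x → x ∈ xs × P x
    count>0⇒∃ xs pos with Any.any? P? xs
    ... | yes any = find any
    ... | no ¬any = contradiction (count-none xs (AllP.¬Any⇒All¬ xs ¬any)) (≢-sym (<⇒≢ pos))

    count+count-∁ : ∀ xs → count P? xs + count (∁? P?) xs ≡ length xs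
    count+count-∁ [] = refl
    count+count-∁ (x ∷ xs) with P? x
    ... | yes _ = cong suc (count+count-∁ xs)
    ... | no _  = trans (+-suc (count P? xs) _) (cong suc (count+count-∁ xs))

  module _ {P Q : Pred A ℓ} (P? : Decidable P) (Q? : Decidable Q) where

    count-mono : ∀ xs → (∀ x → x ∈ xs → P x → Q x) → count P? xs ≤ count Q? xs
    count-mono [] _ = z≤n
    count-mono (x ∷ xs) f with P? x | Q? x
    ... | yes _  | yes _  = s≤s (count-mono xs (λ y → f y ∘ there))
    ... | yes px | no ¬qx = contradiction (f x (here refl) px) ¬qx
    ... | no _   | yes _  = m≤n⇒m≤1+n (count-mono xs (λ y → f y ∘ there))
    ... | no _   | no _   = count-mono xs (λ y → f y ∘ there)

    count-mono-tight : ∀ xs → (∀ x → x ∈ xs → P x → Q x) → count Q? xs ≤ count P? xs →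
                       ∀ x → x ∈ xs → Q x → P x
    count-mono-tight (y ∷ xs) f le x x∈ qx with P? y | Q? y | x∈
    ... | yes py | _      | here refl = py
    ... | no _   | no ¬qy | here refl = contradiction qx ¬qy
    ... | no _   | yes _  | here refl = contradiction le (<⇒≱ (s≤s (count-mono xs (λ z → f z ∘ there))))
    ... | yes py | no ¬qy | there _   = contradiction (f y (here refl) py) ¬qy
    ... | yes _  | yes _  | there m   = count-mono-tight xs (λ z → f z ∘ there) (≤-pred le) x m qx
    ... | no _   | yes _  | there m   = count-mono-tight xs (λ z → f z ∘ there) (<⇒≤ le) x m qx
    ... | no _   | no _   | there m   = count-mono-tight xs (λ z → f z ∘ there) le x m qx

  module _ {P Q R : Pred A ℓ} (P? : Decidable P) (Q? : Decidable Q) (R? : Decidable R) where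

    count-disjoint : ∀ xs → (∀ x → x ∈ xs → P x → Q x → ⊥) → (∀ x → x ∈ xs → P x → R x) →
                     (∀ x → x ∈ xs → Q x → R x) → count P? xs + count Q? xs ≤ count R? xs
    count-disjoint [] _ _ _ = z≤n
    count-disjoint (x ∷ xs) d f g with P? x | Q? x | R? x
    ... | yes px | yes qx | _      = contradiction qx (d x (here refl) px)
    ... | yes px | no _   | no ¬rx = contradiction (f x (here refl) px) ¬rx
    ... | no _   | yes qx | no ¬rx = contradiction (g x (here refl) qx) ¬rx
    ... | yes _  | no _   | yes _  = s≤s (count-disjoint xs (λ y → d y ∘ there) (λ y → f y ∘ there) (λ y → g y ∘ there))
    ... | no _   | yes _  | yes _  = subst (_≤ suc (count R? xs)) (sym (+-suc (count P? xs) (count Q? xs)))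
                                        (s≤s (count-disjoint xs (λ y → d y ∘ there) (λ y → f y ∘ there) (λ y → g y ∘ there)))
    ... | no _   | no _   | yes _  = m≤n⇒m≤1+n (count-disjoint xs (λ y → d y ∘ there) (λ y → f y ∘ there) (λ y → g y ∘ there))
    ... | no _   | no _   | no _   = count-disjoint xs (λ y → d y ∘ there) (λ y → f y ∘ there) (λ y → g y ∘ there)

    count-∪ : ∀ xs → (∀ x → x ∈ xs → R x → P x ⊎ Q x) → count R? xs ≤ count P? xs + count Q? xs
    count-∪ [] _ = z≤n
    count-∪ (x ∷ xs) f with R? x
    ... | no _ = ≤-trans (count-∪ xs (λ y → f y ∘ there)) (+-mono-≤ (count≤count-∷ P? x xs) (count≤count-∷ Q? x xs))
    ... | yes rx with P? x
    ...   | yes _ = s≤s (≤-trans (count-∪ xs (λ y → f y ∘ there)) (+-monoʳ-≤ (count P? xs) (count≤count-∷ Q? x xs)))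
    ...   | no ¬px with Q? x
    ...     | yes _  = subst (suc (count R? xs) ≤_) (sym (+-suc (count P? xs) (count Q? xs))) (s≤s (count-∪ xs (λ y → f y ∘ there)))
    ...     | no ¬qx = ⊥-elim ([ ¬px , ¬qx ]′ (f x (here refl) rx))

module _ {a ℓ} {A : Set a} {B : Set a} {P : Pred B ℓ} {Q : Pred A ℓ} (P? : Decidable P) (Q? : Decidable Q) where

  count-map : ∀ (f : A → B) xs → (∀ x → P (f x) → Q x) → (∀ x → Q x → P (f x)) → count P? (map f xs) ≡ count Q? xs
  count-map f [] _ _ = refl
  count-map f (x ∷ xs) pq qp with P? (f x) | Q? x
  ... | yes _ | yes _  = cong suc (count-map f xs pq qp)
  ... | yes p | no ¬q  = contradiction (pq x p) ¬q
  ... | no ¬p | yes q  = contradiction (qp x q) ¬p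
  ... | no _  | no _   = count-map f xs pq qp

module _ {a ℓ} {A : Set a} {P : Pred A ℓ} (P? : Decidable P) where

  count-∷-cong : ∀ {x y xs ys} → (P x → P y) → (P y → P x) → count P? xs ≡ count P? ys →
                 count P? (x ∷ xs) ≡ count P? (y ∷ ys)
  count-∷-cong {x} {y} f g eq with P? x | P? y
  ... | yes _  | yes _  = cong suc eq
  ... | yes px | no ¬py = contradiction (f px) ¬py
  ... | no ¬px | yes py = contradiction (g py) ¬px
  ... | no _   | no _   = eq

  ↭-filter-∁ : ∀ xs → xs ↭ filter P? xs ++ filter (∁? P?) xs
  ↭-filter-∁ [] = ↭-refl
  ↭-filter-∁ (x ∷ xs) with P? x
  ... | yes _ = prep x (↭-filter-∁ xs)
  ... | no _  = ↭-trans (prep x (↭-filter-∁ xs)) (↭-sym (shift x (filter P? xs) _))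

module _ {a ℓ} {A : Set a} {R : A → A → Set ℓ} where

  AllPairs-++-cross : ∀ xs {ys} → AllPairs R (xs ++ ys) → ∀ {x y} → x ∈ xs → y ∈ ys → R x y
  AllPairs-++-cross (x ∷ xs) (rx ∷ _) (here refl) y∈ys = All.lookup (AllP.++⁻ʳ xs rx) y∈ys
  AllPairs-++-cross (x ∷ xs) (_ ∷ r) (there x∈xs) y∈ys = AllPairs-++-cross xs r x∈xs y∈ys

  AllPairs-++⁻ˡ : ∀ xs {ys} → AllPairs R (xs ++ ys) → AllPairs R xs
  AllPairs-++⁻ˡ [] _ = []
  AllPairs-++⁻ˡ (x ∷ xs) (rx ∷ r) = AllP.++⁻ˡ xs rx ∷ AllPairs-++⁻ˡ xs r

  AllPairs-++⁻ʳ : ∀ xs {ys} → AllPairs R (xs ++ ys) → AllPairs R ys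
  AllPairs-++⁻ʳ [] r = r
  AllPairs-++⁻ʳ (x ∷ xs) (_ ∷ r) = AllPairs-++⁻ʳ xs r

length-∈ : ∀ {a} {A : Set a} {x : A} {xs} → x ∈ xs → 1 ≤ length xs
length-∈ (here _) = s≤s z≤n
length-∈ (there _) = s≤s z≤n

concatMap-++ : ∀ {a b} {A : Set a} {B : Set b} (f : A → List B) xs ys → concatMap f (xs ++ ys) ≡ concatMap f xs ++ concatMap f ys
concatMap-++ f xs ys = trans (cong concat (map-++ f xs ys)) (sym (concat-++ (map f xs) (map f ys)))

Unique-↭ : ∀ {a} {A : Set a} {xs ys : List A} → xs ↭ ys → Unique xs → Unique ys
Unique-↭ xs↭ys = ↭ₛ.Unique-resp-↭ (setoid _) (↭⇒↭ₛ xs↭ys)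

map≡++⇒split : ∀ {a b} {A : Set a} {B : Set b} (f : A → B) xs ys zs → map f xs ≡ ys ++ zs →
               ∃₂ λ xs₁ xs₂ → xs ≡ xs₁ ++ xs₂ × map f xs₁ ≡ ys × map f xs₂ ≡ zs
map≡++⇒split f xs [] zs eq = [] , xs , refl , refl , eq
map≡++⇒split f (x ∷ xs) (y ∷ ys) zs eq with map≡++⇒split f xs ys zs (proj₂ (∷-injective eq))
... | xs₁ , xs₂ , refl , refl , refl = x ∷ xs₁ , xs₂ , refl , cong (_∷ _) (proj₁ (∷-injective eq)) , refl

∈-take⁻ : ∀ {a} {A : Set a} n {xs : List A} {v} → v ∈ take n xs → v ∈ xs
∈-take⁻ (suc n) {x ∷ xs} (here refl) = here refl
∈-take⁻ (suc n) {x ∷ xs} (there m) = there (∈-take⁻ n m)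

bound : ℕ → ℕ
bound s = 3 ⊔ (2 * s ∸ 5)

bound-5+ : ∀ t → bound (5 + t) ≡ 5 + (t + t)
bound-5+ t = cong (λ z → 3 ⊔ (z ∸ 5)) (solve t)
  where
  solve : ∀ t → 2 * (5 + t) ≡ 5 + (5 + (t + t))
  solve = Data.Nat.Tactic.RingSolver.solve-∀

bound-4+ : ∀ t → bound (4 + t) ≡ 3 + (t + t)
bound-4+ t = cong (λ z → 3 ⊔ (z ∸ 5)) (solve t)
  where
  solve : ∀ t → 2 * (4 + t) ≡ 5 + (3 + (t + t))
  solve = Data.Nat.Tactic.RingSolver.solve-∀

double≤1+double⇒≤ : ∀ j t → j + j ≤ suc (t + t) → j ≤ t
double≤1+double⇒≤ zero t _ = z≤n
double≤1+double⇒≤ (suc j) zero (s≤s le) = ⊥-elim (n≮0 (subst (_≤ 0) (+-suc j j) le))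
double≤1+double⇒≤ (suc j) (suc t) (s≤s le) rewrite +-suc j j | +-suc t t = s≤s (double≤1+double⇒≤ j t (≤-pred le))

double≤bound⇒≤∸2 : ∀ s j → 3 ≤ s → j + j ≤ bound s → j ≤ s ∸ 2
double≤bound⇒≤∸2 zero j () _
double≤bound⇒≤∸2 (suc zero) j (s≤s ()) _
double≤bound⇒≤∸2 (suc (suc zero)) j (s≤s (s≤s ())) _
double≤bound⇒≤∸2 (suc (suc (suc zero))) j _ le = double≤1+double⇒≤ j 1 le
double≤bound⇒≤∸2 (suc (suc (suc (suc zero)))) j _ le = ≤-trans (double≤1+double⇒≤ j 1 le) (s≤s z≤n)
double≤bound⇒≤∸2 (suc (suc (suc (suc (suc t))))) j _ le = ≤-trans (double≤1+double⇒≤ j (2 + t) (subst (j + j ≤_) (trans (bound-5+ t) (solve t)) le)) (n≤1+n (2 + t))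
  where
  solve : ∀ t → 5 + (t + t) ≡ suc ((2 + t) + (2 + t))
  solve = Data.Nat.Tactic.RingSolver.solve-∀

double≤bound⇒+3≤ : ∀ s j → 4 ≤ s → j + j ≤ bound s → j + 3 ≤ s
double≤bound⇒+3≤ zero j () _
double≤bound⇒+3≤ (suc zero) j (s≤s ()) _
double≤bound⇒+3≤ (suc (suc zero)) j (s≤s (s≤s ())) _
double≤bound⇒+3≤ (suc (suc (suc zero))) j (s≤s (s≤s (s≤s ()))) _
double≤bound⇒+3≤ (suc (suc (suc (suc zero)))) j _ le = +-monoˡ-≤ 3 (double≤1+double⇒≤ j 1 le)
double≤bound⇒+3≤ (suc (suc (suc (suc (suc t))))) j _ le = ≤-trans (+-monoˡ-≤ 3 (double≤1+double⇒≤ j (2 + t) (subst (j + j ≤_) (trans (bound-5+ t) (solve t)) le))) (≤-reflexive (solve′ t))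
  where
  solve : ∀ t → 5 + (t + t) ≡ suc ((2 + t) + (2 + t))
  solve = Data.Nat.Tactic.RingSolver.solve-∀
  solve′ : ∀ t → 2 + t + 3 ≡ 5 + t
  solve′ = Data.Nat.Tactic.RingSolver.solve-∀

bound-exceeded⇒tight : ∀ s' m d → m ≤ bound (suc s') → ¬ (m ≤ d + bound s') → 1 ≤ d → Σ ℕ λ t → s' ≡ 4 + t × d ≡ 1 × m ≡ 5 + (t + t)
bound-exceeded⇒tight zero m d le nle _ = ⊥-elim (nle (≤-trans le (m≤n+m 3 d)))
bound-exceeded⇒tight (suc zero) m d le nle _ = ⊥-elim (nle (≤-trans le (m≤n+m 3 d)))
bound-exceeded⇒tight (suc (suc zero)) m d le nle _ = ⊥-elim (nle (≤-trans le (m≤n+m 3 d)))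
bound-exceeded⇒tight (suc (suc (suc zero))) m d le nle _ = ⊥-elim (nle (≤-trans le (m≤n+m 3 d)))
bound-exceeded⇒tight (suc (suc (suc (suc t)))) m d le nle d1 = t , refl , deq , meq
  where
  le' : m ≤ 5 + (t + t)
  le' = subst (m ≤_) (bound-5+ t) le
  gt : d + (3 + (t + t)) < m
  gt = subst (λ z → d + z < m) (bound-4+ t) (≰⇒> nle)
  meq : m ≡ 5 + (t + t)
  meq = ≤-antisym le' (≤-trans (s≤s (+-monoˡ-≤ (3 + (t + t)) d1)) gt)
  deq : d ≡ 1
  deq = ≤-antisym (+-cancelʳ-≤ (4 + (t + t)) d 1 (≤-trans (≤-reflexive (solve d t)) (≤-trans gt (≤-reflexive meq)))) d1
    where
    solve : ∀ d t → d + (4 + (t + t)) ≡ suc (d + (3 + (t + t)))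
    solve = Data.Nat.Tactic.RingSolver.solve-∀

≤4+⇒<5+double : ∀ t a → a ≤ 4 + t → a < 5 + (t + t)
≤4+⇒<5+double t a le = s≤s (≤-trans le (+-monoʳ-≤ 4 (m≤m+n t t)))

reduced-length-≤bound : ∀ t L dy → L + dy + 1 ≡ 5 + (t + t) → 1 ≤ dy → L ≤ bound (4 + t)
reduced-length-≤bound t L dy eq d1 = subst (L ≤_) (sym (bound-4+ t)) (+-cancelʳ-≤ 2 L (3 + (t + t))
    (≤-trans (≤-trans (≤-reflexive (solve L)) (+-monoˡ-≤ 1 (+-monoʳ-≤ L d1))) (≤-reflexive (trans eq (solve′ t)))))
  where
  solve : ∀ L → L + 2 ≡ L + 1 + 1
  solve = Data.Nat.Tactic.RingSolver.solve-∀
  solve′ : ∀ t → 5 + (t + t) ≡ 3 + (t + t) + 2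
  solve′ = Data.Nat.Tactic.RingSolver.solve-∀

+3≤⇒+1≤∸1 : ∀ s d → d + 3 ≤ suc s → d + 1 ≤ s ∸ 1
+3≤⇒+1≤∸1 s d le = subst (_≤ s ∸ 1) (+-comm 1 d) (go s (subst (_≤ suc s) (+-comm d 3) le))
  where
  go : ∀ s → 3 + d ≤ suc s → suc d ≤ s ∸ 1
  go zero (s≤s ())
  go (suc zero) (s≤s (s≤s ()))
  go (suc (suc s)) (s≤s (s≤s (s≤s le))) = s≤s le

+3≤⇒≤∸1 : ∀ s d → d + 3 ≤ suc s → d ≤ s ∸ 1
+3≤⇒≤∸1 s d le = ≤-trans (m≤m+n d 1) (+3≤⇒+1≤∸1 s d le)

fresh-degree-≤∸1 : ∀ s a b c d → a + b + c ≡ d + 1 → d + 3 ≤ suc s → a ≤ s ∸ 1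
fresh-degree-≤∸1 s a b c d eq le = ≤-trans (m≤m+n a (b + c)) (≤-trans (≤-reflexive (trans (sym (+-assoc a b c)) eq)) (+3≤⇒+1≤∸1 s d le))

lost-degree-≤∸1 : ∀ s a b c d → a + b + c ≡ d + 0 → 1 ≤ b + c → d ≤ s → a ≤ s ∸ 1
lost-degree-≤∸1 s a b c d eq one le = ≤-pred (begin
  suc a         ≡⟨ +-comm 1 a ⟩
  a + 1         ≤⟨ +-monoʳ-≤ a one ⟩
  a + (b + c)   ≡⟨ trans (sym (+-assoc a b c)) (trans eq (+-identityʳ d)) ⟩
  d             ≤⟨ le ⟩
  s             ≤⟨ m≤n+m∸n s 1 ⟩
  suc (s ∸ 1)   ∎)
  where open ≤-Reasoning

kept-degree-≤∸1 : ∀ s a b c d → a + b + c ≡ d + 0 → d ≤ s ∸ 1 → a ≤ s ∸ 1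
kept-degree-≤∸1 s a b c d eq le = ≤-trans (m≤m+n a (b + c)) (≤-trans (≤-reflexive (trans (sym (+-assoc a b c)) (trans eq (+-identityʳ d)))) le)

argmax : ∀ {a} {A : Set a} (f : A → ℕ) (z : A) (xs : List A) →
         ∃ λ x → (x ≡ z ⊎ x ∈ xs) × f z ≤ f x × (∀ {v} → v ∈ xs → f v ≤ f x)
argmax f z [] = z , inj₁ refl , ≤-refl , λ ()
argmax f z (u ∷ xs) with argmax f z xs
... | x , x∈ , z≤x , max with f u ≤? f x
...   | yes u≤x = x , Data.Sum.map id there x∈ , z≤x , λ { (here refl) → u≤x ; (there v∈) → max v∈ }
...   | no u≰x  = u , inj₂ (here refl) , ≤-trans z≤x x≤u , λ { (here refl) → ≤-refl ; (there v∈) → ≤-trans (max v∈) x≤u }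
  where
  x≤u : f x ≤ f u
  x≤u = <⇒≤ (≰⇒> u≰x)

data Dedup {a} {A : Set a} : List A → List A → List A → Set a where
  [] : Dedup [] [] []
  new : ∀ {x xs ds rs} → x ∉ ds → Dedup xs ds rs → Dedup (x ∷ xs) (x ∷ ds) rs
  dup : ∀ {x xs ds rs} → x ∈ ds → Dedup xs ds rs → Dedup (x ∷ xs) ds (x ∷ rs)

module _ {a} {A : Set a} where

  Dedup-unique : ∀ {xs ds rs : List A} → Dedup xs ds rs → Unique ds
  Dedup-unique [] = []
  Dedup-unique (new x∉ds p) = AllP.¬Any⇒All¬ _ x∉ds ∷ Dedup-unique p
  Dedup-unique (dup _ p) = Dedup-unique p

  Dedup-↭ : ∀ {xs ds rs : List A} → Dedup xs ds rs → ds ++ rs ↭ xs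
  Dedup-↭ [] = ↭-refl
  Dedup-↭ (new _ p) = prep _ (Dedup-↭ p)
  Dedup-↭ {x ∷ _} {ds} {_ ∷ rs} (dup _ p) = ↭-trans (shift x ds rs) (prep x (Dedup-↭ p))

  Dedup-repeats⊆distinct : ∀ {xs ds rs : List A} → Dedup xs ds rs → All (_∈ ds) rs
  Dedup-repeats⊆distinct [] = []
  Dedup-repeats⊆distinct (new _ p) = All.map there (Dedup-repeats⊆distinct p)
  Dedup-repeats⊆distinct (dup x∈ds p) = x∈ds ∷ Dedup-repeats⊆distinct p

  Dedup-length : ∀ {xs ds rs : List A} → Dedup xs ds rs → length ds + length rs ≡ length xs
  Dedup-length {ds = ds} p = trans (sym (length-++ ds)) (↭-length (Dedup-↭ p))

  Dedup-distinct⊆ : ∀ {xs ds rs : List A} → Dedup xs ds rs → ∀ {v} → v ∈ ds → v ∈ xs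
  Dedup-distinct⊆ p v∈ = ∈-resp-↭ (Dedup-↭ p) (∈-++⁺ˡ v∈)

  Dedup-⊆distinct : ∀ {xs ds rs : List A} → Dedup xs ds rs → ∀ {v} → v ∈ xs → v ∈ ds
  Dedup-⊆distinct p v∈ with ∈-++⁻ _ (∈-resp-↭ (↭-sym (Dedup-↭ p)) v∈)
  ... | inj₁ v∈ds = v∈ds
  ... | inj₂ v∈rs = All.lookup (Dedup-repeats⊆distinct p) v∈rs

module DecidableLists {a} {A : Set a} (_≟_ : DecidableEquality A) where

  open import Data.List.Membership.DecPropositional _≟_ using (_∈?_) public

  dedup : ∀ xs → ∃₂ λ ds rs → Dedup xs ds rs
  dedup [] = [] , [] , []
  dedup (x ∷ xs) with dedup xs
  ... | ds , rs , p with x ∈? ds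
  ...   | yes x∈ds = ds , x ∷ rs , dup x∈ds p
  ...   | no x∉ds  = x ∷ ds , rs , new x∉ds p

  occ : A → List A → ℕ
  occ v = count (_≟ v)

  occ≤1 : ∀ {xs} v → Unique xs → occ v xs ≤ 1
  occ≤1 {[]} v _ = z≤n
  occ≤1 {x ∷ xs} v (x∉xs ∷ unique) with x ≟ v
  ... | yes refl = s≤s (≤-reflexive (count-none (_≟ v) xs (All.map ≢-sym x∉xs)))
  ... | no _     = occ≤1 v unique

  occ≡1 : ∀ {xs} v → Unique xs → v ∈ xs → occ v xs ≡ 1
  occ≡1 {x ∷ xs} v (x∉xs ∷ _) (here refl) = trans (count-accept (_≟ v) xs refl) (cong suc (count-none (_≟ v) xs (All.map ≢-sym x∉xs)))
  occ≡1 {x ∷ xs} v (x∉xs ∷ unique) (there v∈) = trans (count-reject (_≟ v) xs (λ { refl → All.lookup x∉xs v∈ refl })) (occ≡1 v unique v∈)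

  occ≡0 : ∀ v xs → v ∉ xs → occ v xs ≡ 0
  occ≡0 v xs v∉ = count-none (_≟ v) xs (All.tabulate λ { x∈ refl → v∉ x∈ })

  count-∈≤length : ∀ {xs} ys → Unique xs → count (_∈? ys) xs ≤ length ys
  count-∈≤length {xs} [] _ = ≤-reflexive (count-none (_∈? []) xs (All.tabulate λ _ ()))
  count-∈≤length {xs} (y ∷ ys) unique =
    ≤-trans (count-∪ (_≟ y) (_∈? ys) (_∈? (y ∷ ys)) xs (λ _ _ → ∈-∷⁻))
            (+-mono-≤ (occ≤1 y unique) (count-∈≤length ys unique))
    where
    ∈-∷⁻ : ∀ {x} → x ∈ y ∷ ys → x ≡ y ⊎ x ∈ ys
    ∈-∷⁻ (here x≡y) = inj₁ x≡y
    ∈-∷⁻ (there x∈ys) = inj₂ x∈ys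

  Unique-⊆⇒length≤ : ∀ {xs ys} → Unique xs → All (_∈ ys) xs → length xs ≤ length ys
  Unique-⊆⇒length≤ {xs} {ys} unique xs⊆ys = ≤-trans (≤-reflexive (sym (count-all (_∈? ys) xs xs⊆ys))) (count-∈≤length ys unique)

  length≤count-∉+length : ∀ xs ys → Unique xs → length xs ≤ count (∁? (_∈? ys)) xs + length ys
  length≤count-∉+length xs ys unique =
    ≤-trans (≤-reflexive (trans (sym (count+count-∁ (_∈? ys) xs)) (+-comm (count (_∈? ys) xs) _)))
            (+-monoʳ-≤ _ (count-∈≤length ys unique))

  without : A → List A → List A
  without y = filter (∁? (_≟ y))

  ∈-without⁻ : ∀ {y xs v} → v ∈ without y xs → v ∈ xs × v ≢ y
  ∈-without⁻ {y} {xs} = ∈-filter⁻ (∁? (_≟ y)) {xs = xs}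

  ∈-without⁺ : ∀ {y xs v} → v ∈ xs → v ≢ y → v ∈ without y xs
  ∈-without⁺ {y} = ∈-filter⁺ (∁? (_≟ y))

  length-without : ∀ y xs → Unique xs → y ∈ xs → suc (length (without y xs)) ≡ length xs
  length-without y xs unique y∈ = trans (cong (_+ length (without y xs)) (sym (occ≡1 y unique y∈))) (count+count-∁ (_≟ y) xs)

  fresh : List A → List A → ℕ → List A
  fresh ys xs k = take k (filter (∁? (_∈? ys)) xs)

  ∈-fresh⁻ : ∀ ys xs k {v} → v ∈ fresh ys xs k → v ∈ xs × v ∉ ys
  ∈-fresh⁻ ys xs k v∈ = ∈-filter⁻ (∁? (_∈? ys)) {xs = xs} (∈-take⁻ k v∈)

  fresh-unique : ∀ ys xs k → Unique xs → Unique (fresh ys xs k)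
  fresh-unique ys xs k unique = UP.take⁺ k (UP.filter⁺ (∁? (_∈? ys)) unique)

  length-fresh : ∀ ys xs k → Unique xs → k + length ys ≤ length xs → length (fresh ys xs k) ≡ k
  length-fresh ys xs k unique room =
    trans (length-take k _) (m≤n⇒m⊓n≡m (+-cancelʳ-≤ (length ys) k _ (≤-trans room (length≤count-∉+length xs ys unique))))

  fresh-++-unique : ∀ {ys xs k zs} → Unique xs → Unique zs → All (_∈ ys) zs → Unique (fresh ys xs k ++ zs)
  fresh-++-unique {ys} {xs} {k} unique zs-unique zs⊆ys =
    UP.++⁺ (fresh-unique ys xs k unique) zs-unique (λ (v∈fresh , v∈zs) → proj₂ (∈-fresh⁻ ys xs k v∈fresh) (All.lookup zs⊆ys v∈zs))

  fresh⊆without : ∀ {y ys xs k} → y ∈ ys → All (_∈ without y xs) (fresh ys xs k)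
  fresh⊆without {y} {ys} {xs} {k} y∈ys = All.tabulate λ v∈ →
    let v∈xs , v∉ys = ∈-fresh⁻ ys xs k v∈ in ∈-without⁺ v∈xs (λ { refl → v∉ys y∈ys })

module Routing {n} (G : SimpleGraph n) where

  snocWalk : ∀ {u v w} → Walk G u v → Adj G v w → Walk G u w
  snocWalk [ u ] a = u ∷⟨ a ⟩ [ _ ]
  snocWalk (u ∷⟨ b ⟩ p) a = u ∷⟨ b ⟩ snocWalk p a

  vertices-snoc : ∀ {u v w} (p : Walk G u v) (a : Adj G v w) → vertices (snocWalk p a) ≡ vertices p ++ (w ∷ [])
  vertices-snoc [ u ] a = refl
  vertices-snoc (u ∷⟨ b ⟩ p) a = cong (u ∷_) (vertices-snoc p a)

  edges-snoc : ∀ {u v w} (p : Walk G u v) (a : Adj G v w) → edges (snocWalk p a) ≡ edges p ++ ((v , w) ∷ [])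
  edges-snoc [ u ] a = refl
  edges-snoc (u ∷⟨ b ⟩ p) a = cong (_ ∷_) (edges-snoc p a)

  reverseWalk : ∀ {u v} → Walk G u v → Walk G v u
  reverseWalk [ u ] = [ u ]
  reverseWalk (u ∷⟨ a ⟩ p) = snocWalk (reverseWalk p) (symm G a)

  vertices-reverse : ∀ {u v} (p : Walk G u v) → vertices (reverseWalk p) ↭ vertices p
  vertices-reverse [ u ] = ↭-refl
  vertices-reverse (u ∷⟨ a ⟩ p) rewrite vertices-snoc (reverseWalk p) (symm G a) =
    ↭-trans (++⁺ʳ (u ∷ []) (vertices-reverse p)) (↭-sym (∷↭∷ʳ u (vertices p)))

  edges-reverse : ∀ {u v} (p : Walk G u v) {e} → e ∈ edges (reverseWalk p) → swap e ∈ edges p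
  edges-reverse (u ∷⟨ a ⟩ p) e∈ rewrite edges-snoc (reverseWalk p) (symm G a) with ∈-++⁻ (edges (reverseWalk p)) e∈
  ... | inj₁ e∈rev = there (edges-reverse p e∈rev)
  ... | inj₂ (here refl) = here refl

  reversePath : ∀ {u v} → Path G u v → Path G v u
  reversePath (mkPath p unique) = mkPath (reverseWalk p) (Unique-↭ (↭-sym (vertices-reverse p)) unique)

  head∈vertices : ∀ {u v} (p : Walk G u v) → u ∈ vertices p
  head∈vertices [ u ] = here refl
  head∈vertices (u ∷⟨ _ ⟩ p) = here refl

  edge∈vertices : ∀ {u v} (p : Walk G u v) {e} → e ∈ edges p → proj₁ e ∈ vertices p × proj₂ e ∈ vertices p
  edge∈vertices (u ∷⟨ a ⟩ p) (here refl) = here refl , there (head∈vertices p)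
  edge∈vertices (u ∷⟨ a ⟩ p) (there e∈) = Data.Product.map there there (edge∈vertices p e∈)

  Route : Set
  Route = Σ (Fin n × Fin n) λ e → Path G (proj₁ e) (proj₂ e)

  routeEdges : Route → List (Fin n × Fin n)
  routeEdges r = edges (walk (proj₂ r))

  routeVertices : Route → List (Fin n)
  routeVertices r = vertices (walk (proj₂ r))

  EdgeDisjoint : Route → Route → Set
  EdgeDisjoint r s = ¬ ShareEdge (walk (proj₂ r)) (walk (proj₂ s))

  EdgeDisjoint-sym : ∀ {r s} → EdgeDisjoint r s → EdgeDisjoint s r
  EdgeDisjoint-sym r∥s (e , e∈s , inj₁ e∈r) = r∥s (e , e∈r , inj₁ e∈s)
  EdgeDisjoint-sym r∥s (e , e∈s , inj₂ e∈r) = r∥s (swap e , e∈r , inj₂ e∈s)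

  record _⊑_ (r' r : Route) : Set where
    constructor sub
    field
      edges⊑    : ∀ e → e ∈ routeEdges r' → e ∈ routeEdges r ⊎ swap e ∈ routeEdges r
      vertices⊑ : ∀ v → v ∈ routeVertices r' → v ∈ routeVertices r

  EdgeDisjoint-mono : ∀ {r r' s s'} → r' ⊑ r → s' ⊑ s → EdgeDisjoint r s → EdgeDisjoint r' s'
  EdgeDisjoint-mono (sub r'⊆r _) (sub s'⊆s _) r∥s (e , e∈r' , e∈s') with r'⊆r e e∈r' | e∈s'
  ... | inj₁ e∈r | inj₁ e∈s' = [ (λ e∈s → r∥s (e , e∈r , inj₁ e∈s)) , (λ e∈s → r∥s (e , e∈r , inj₂ e∈s)) ]′ (s'⊆s e e∈s')
  ... | inj₁ e∈r | inj₂ e∈s' = [ (λ e∈s → r∥s (e , e∈r , inj₂ e∈s)) , (λ e∈s → r∥s (e , e∈r , inj₁ e∈s)) ]′ (s'⊆s (swap e) e∈s')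
  ... | inj₂ e∈r | inj₁ e∈s' = [ (λ e∈s → r∥s (swap e , e∈r , inj₂ e∈s)) , (λ e∈s → r∥s (swap e , e∈r , inj₁ e∈s)) ]′ (s'⊆s e e∈s')
  ... | inj₂ e∈r | inj₂ e∈s' = [ (λ e∈s → r∥s (swap e , e∈r , inj₁ e∈s)) , (λ e∈s → r∥s (swap e , e∈r , inj₂ e∈s)) ]′ (s'⊆s (swap e) e∈s')

  All-EdgeDisjoint-mono : ∀ {r r' ss ss'} → r' ⊑ r → Pointwise _⊑_ ss' ss → All (EdgeDisjoint r) ss → All (EdgeDisjoint r') ss'
  All-EdgeDisjoint-mono r'⊑r [] [] = []
  All-EdgeDisjoint-mono r'⊑r (s'⊑s ∷ ss'⊑ss) (r∥s ∷ r∥ss) = EdgeDisjoint-mono r'⊑r s'⊑s r∥s ∷ All-EdgeDisjoint-mono r'⊑r ss'⊑ss r∥ss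

  AllPairs-EdgeDisjoint-mono : ∀ {rs rs'} → Pointwise _⊑_ rs' rs → AllPairs EdgeDisjoint rs → AllPairs EdgeDisjoint rs'
  AllPairs-EdgeDisjoint-mono [] [] = []
  AllPairs-EdgeDisjoint-mono (r'⊑r ∷ rs'⊑rs) (r∥rs ∷ pairwise) =
    All-EdgeDisjoint-mono r'⊑r rs'⊑rs r∥rs ∷ AllPairs-EdgeDisjoint-mono rs'⊑rs pairwise

  AllPairs-EdgeDisjoint-↭ : ∀ {rs rs'} → rs ↭ rs' → AllPairs EdgeDisjoint rs → AllPairs EdgeDisjoint rs'
  AllPairs-EdgeDisjoint-↭ rs↭rs' =
    ↭ₛ.AllPairs-resp-↭ (setoid Route) (λ {r} {s} → EdgeDisjoint-sym {r} {s}) (resp₂ EdgeDisjoint) (↭⇒↭ₛ rs↭rs')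

  RouteWithin : List (Fin n) → Route → Set
  RouteWithin S r = All (_∈ S) (routeVertices r)

  RealizableWithin : List (Fin n) → Multigraph n → Set
  RealizableWithin S D = Σ (List Route) λ rs → map proj₁ rs ≡ D × AllPairs EdgeDisjoint rs × All (RouteWithin S) rs

  RealizableWithin-↭ : ∀ {S D D'} → D ↭ D' → RealizableWithin S D → RealizableWithin S D'
  RealizableWithin-↭ D↭D' (rs , refl , pairwise , within) with ↭-map-inv proj₁ D↭D'
  ... | rs' , refl , rs↭rs' =
    rs' , refl ,
    AllPairs-EdgeDisjoint-↭ rs↭rs' pairwise ,
    All-resp-↭ rs↭rs' within

  data Reorient : Multigraph n → Multigraph n → Set where
    [] : Reorient [] []
    keep : ∀ {e D D'} → Reorient D D' → Reorient (e ∷ D) (e ∷ D')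
    flip : ∀ {e D D'} → Reorient D D' → Reorient (e ∷ D) (swap e ∷ D')

  reorient-refl : ∀ D → Reorient D D
  reorient-refl [] = []
  reorient-refl (e ∷ D) = keep (reorient-refl D)

  reorient-++ : ∀ {D₁ D₁' D₂ D₂'} → Reorient D₁ D₁' → Reorient D₂ D₂' → Reorient (D₁ ++ D₂) (D₁' ++ D₂')
  reorient-++ [] D₂~D₂' = D₂~D₂'
  reorient-++ (keep D₁~D₁') D₂~D₂' = keep (reorient-++ D₁~D₁' D₂~D₂')
  reorient-++ (flip D₁~D₁') D₂~D₂' = flip (reorient-++ D₁~D₁' D₂~D₂')

  reorientRoutes : ∀ {D D'} → Reorient D D' → (rs : List Route) → map proj₁ rs ≡ D →
                   ∃ λ rs' → map proj₁ rs' ≡ D' × Pointwise _⊑_ rs' rs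
  reorientRoutes [] [] refl = [] , refl , []
  reorientRoutes (keep D~D') (r ∷ rs) refl with reorientRoutes D~D' rs refl
  ... | rs' , refl , rs'⊑rs = r ∷ rs' , refl , sub (λ _ → inj₁) (λ _ v∈ → v∈) ∷ rs'⊑rs
  reorientRoutes (flip D~D') (((u , v) , p) ∷ rs) refl with reorientRoutes D~D' rs refl
  ... | rs' , refl , rs'⊑rs =
    ((v , u) , reversePath p) ∷ rs' , refl ,
    sub (λ _ → inj₂ ∘ edges-reverse (walk p)) (λ _ → ∈-resp-↭ (vertices-reverse (walk p))) ∷ rs'⊑rs

  RealizableWithin-reorient : ∀ {S D D'} → Reorient D D' → RealizableWithin S D → RealizableWithin S D'
  RealizableWithin-reorient D~D' (rs , refl , pairwise , within) with reorientRoutes D~D' rs refl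
  ... | rs' , eq , rs'⊑rs =
    rs' , eq , AllPairs-EdgeDisjoint-mono rs'⊑rs pairwise , pointwise-within rs'⊑rs within
    where
    pointwise-within : ∀ {S ss' ss} → Pointwise _⊑_ ss' ss → All (RouteWithin S) ss → All (RouteWithin S) ss'
    pointwise-within [] [] = []
    pointwise-within (sub _ V⊆ ∷ ss'⊑ss) (w ∷ ws) = All.tabulate (λ v∈ → All.lookup w (V⊆ _ v∈)) ∷ pointwise-within ss'⊑ss ws

  routeAt : (rs : List Route) (i : Fin (length (map proj₁ rs))) →
            Path G (proj₁ (lookup (map proj₁ rs) i)) (proj₂ (lookup (map proj₁ rs) i))
  routeAt (r ∷ rs) Fin.zero = proj₂ r
  routeAt (r ∷ rs) (Fin.suc i) = routeAt rs i

  RealizableWithin⇒Realizable : ∀ {S D} → RealizableWithin S D → Realizable G D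
  RealizableWithin⇒Realizable (rs , refl , pairwise , _) = routeAt rs , disjoint rs pairwise
    where
    disjoint-from : ∀ {r} rs → All (EdgeDisjoint r) rs → ∀ j → ¬ ShareEdge (walk (proj₂ r)) (walk (routeAt rs j))
    disjoint-from (_ ∷ _) (r∥s ∷ _) Fin.zero = r∥s
    disjoint-from {r} (_ ∷ rs) (_ ∷ r∥rs) (Fin.suc j) = disjoint-from {r} rs r∥rs j
    disjoint : ∀ rs → AllPairs EdgeDisjoint rs → ∀ i j → ¬ i ≡ j → ¬ ShareEdge (walk (routeAt rs i)) (walk (routeAt rs j))
    disjoint (r ∷ rs) (r∥rs ∷ _) Fin.zero Fin.zero i≢j = ⊥-elim (i≢j refl)
    disjoint (r ∷ rs) (r∥rs ∷ _) Fin.zero (Fin.suc j) _ = disjoint-from {r} rs r∥rs j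
    disjoint (r ∷ rs) (r∥rs ∷ _) (Fin.suc i) Fin.zero _ =
      EdgeDisjoint-sym {r} {lookup (map proj₁ rs) i , routeAt rs i} (disjoint-from {r} rs r∥rs i)
    disjoint (r ∷ rs) (_ ∷ pairwise) (Fin.suc i) (Fin.suc j) i≢j = disjoint rs pairwise i j (i≢j ∘ cong Fin.suc)

module _ (N : ℕ) where
  open DecidableLists (_≟_ {N})

  V : Set
  V = Fin N

  open Routing (K N)

  Incident : V → V × V → Set
  Incident v e = (proj₁ e ≡ v) ⊎ (proj₂ e ≡ v)

  incident? : (v : V) → Decidable (Incident v)
  incident? v e = (proj₁ e ≟ v) ⊎-dec (proj₂ e ≟ v)

  nonincident? : (v : V) → Decidable (λ e → ¬ Incident v e)
  nonincident? v = ∁? (incident? v)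

  edgesAt : Multigraph N → V → Multigraph N
  edgesAt D y = filter (incident? y) D
  edgesAvoiding : Multigraph N → V → Multigraph N
  edgesAvoiding D y = filter (nonincident? y) D

  opposite : V → V × V → V
  opposite y e with proj₁ e ≟ y
  ... | yes _ = proj₂ e
  ... | no _ = proj₁ e

  reorient-edgesAt : ∀ y D → All (Incident y) D → Reorient (map (y ,_) (map (opposite y) D)) D
  reorient-edgesAt y [] [] = []
  reorient-edgesAt y ((u , v) ∷ D) (y∈e ∷ y∈D) with u ≟ y | y∈e
  ... | yes refl | _        = keep (reorient-edgesAt y D y∈D)
  ... | no u≢y   | inj₁ u≡y = ⊥-elim (u≢y u≡y)
  ... | no _     | inj₂ refl = flip (reorient-edgesAt y D y∈D)

  opposite-incident : ∀ y e → Incident (opposite y e) e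
  opposite-incident y (u , v) with u ≟ y
  ... | yes _ = inj₂ refl
  ... | no _ = inj₁ refl

  opposite-≢ : ∀ y e → ¬ proj₁ e ≡ proj₂ e → Incident y e → opposite y e ≢ y
  opposite-≢ y (u , v) lp t with u ≟ y
  ... | yes refl = λ e → lp (sym e)
  ... | no ne = ne

  opposite-unique : ∀ y v e → Incident y e → Incident v e → v ≢ y → opposite y e ≡ v
  opposite-unique y v (u , w) ty tv ne with u ≟ y
  opposite-unique y v (u , w) ty (inj₁ refl) ne | yes refl = ⊥-elim (ne refl)
  opposite-unique y v (u , w) ty (inj₂ refl) ne | yes refl = refl
  opposite-unique y v (u , w) (inj₁ e) tv ne | no n = ⊥-elim (n e)
  opposite-unique y v (u , w) (inj₂ refl) (inj₁ refl) ne | no n = refl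
  opposite-unique y v (u , w) (inj₂ refl) (inj₂ refl) ne | no n = ⊥-elim (ne refl)

  EdgeWithin : List V → V × V → Set
  EdgeWithin S e = proj₁ e ∈ S × proj₂ e ∈ S

  opposite-within : ∀ {S} y e → EdgeWithin S e → opposite y e ∈ S
  opposite-within y (u , v) (a , b) with u ≟ y
  ... | yes _ = b
  ... | no _ = a

  pairUp : List V → List V → Multigraph N
  pairUp (w ∷ W) (e ∷ E) = (w , e) ∷ pairUp W E
  pairUp _ _ = []

  map-proj₁-pairUp : ∀ W El → length W ≡ length El → map proj₁ (pairUp W El) ≡ W
  map-proj₁-pairUp [] [] _ = refl
  map-proj₁-pairUp (w ∷ W) (e ∷ El) eq = cong (w ∷_) (map-proj₁-pairUp W El (suc-injective eq))

  map-proj₂-pairUp : ∀ W El → length W ≡ length El → map proj₂ (pairUp W El) ≡ El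
  map-proj₂-pairUp [] [] _ = refl
  map-proj₂-pairUp (w ∷ W) (e ∷ El) eq = cong (e ∷_) (map-proj₂-pairUp W El (suc-injective eq))

  endpoints : Multigraph N → List V
  endpoints [] = []
  endpoints (e ∷ H) = proj₁ e ∷ proj₂ e ∷ endpoints H

  neighbours-within : ∀ {S D y Nl El} → Loopless D → All (EdgeWithin S) D →
                      Dedup (map (opposite y) (edgesAt D y)) Nl El → All (λ a → a ≢ y × a ∈ S) Nl
  neighbours-within {S} {D} {y} loopless D⊆S nbrs = All.tabulate λ a∈ →
    let e , e∈ , a≡ = ∈-map⁻ (opposite y) (Dedup-distinct⊆ nbrs a∈)
        e∈D , y∈e = ∈-filter⁻ (incident? y) {xs = D} e∈ in
    subst (λ a → a ≢ y × a ∈ S) (sym a≡) (opposite-≢ y e (All.lookup loopless e∈D) y∈e , opposite-within y e (All.lookup D⊆S e∈D))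

  Incident-swap : ∀ v e → Incident v (swap e) → Incident v e
  Incident-swap v e (inj₁ x) = inj₂ x
  Incident-swap v e (inj₂ x) = inj₁ x

  degree-reorient : ∀ {a b} v → Reorient a b → degree a v ≡ degree b v
  degree-reorient v [] = refl
  degree-reorient {e ∷ _} v (keep f) = count-∷-cong (incident? v) {x = e} {y = e} id id (degree-reorient v f)
  degree-reorient {e ∷ _} v (flip f) = count-∷-cong (incident? v) (Incident-swap v (swap e)) (Incident-swap v e) (degree-reorient v f)

  degree-spokes : ∀ y v → v ≢ y → ∀ L → degree (map (y ,_) L) v ≡ occ v L
  degree-spokes y v ne L = count-map (incident? v) (λ a → a ≟ v) (y ,_) L
    (λ { x (inj₁ e) → ⊥-elim (ne (sym e)) ; x (inj₂ e) → e }) (λ x e → inj₂ e)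

  degree-pairUp : ∀ v W El → length W ≡ length El → (∀ {w e} → w ∈ W → e ∈ El → w ≢ e) →
            degree (pairUp W El) v ≡ occ v W + occ v El
  degree-pairUp v [] [] _ _ = refl
  degree-pairUp v [] (e ∷ El) ()
  degree-pairUp v (w ∷ W) [] ()
  degree-pairUp v (w ∷ W) (e ∷ El) eq ne
    with w ≟ v | e ≟ v | degree-pairUp v W El (suc-injective eq) (λ w∈ e∈ → ne (there w∈) (there e∈))
  ... | yes refl | yes refl | _  = ⊥-elim (ne (here refl) (here refl) refl)
  ... | yes _    | no _     | ih = cong suc ih
  ... | no _     | yes _    | ih = trans (cong suc ih) (sym (+-suc (occ v W) (occ v El)))
  ... | no _     | no _     | ih = ih

  length-pairUp : ∀ W El → length W ≡ length El → length (pairUp W El) ≡ length El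
  length-pairUp [] [] _ = refl
  length-pairUp [] (e ∷ El) ()
  length-pairUp (w ∷ W) [] ()
  length-pairUp (w ∷ W) (e ∷ El) eq = cong suc (length-pairUp W El (suc-injective eq))

  ∈-pairUp : ∀ W El {e} → e ∈ pairUp W El → proj₁ e ∈ W × proj₂ e ∈ El
  ∈-pairUp (w ∷ W) (_ ∷ El) (here refl) = here refl , here refl
  ∈-pairUp (w ∷ W) (_ ∷ El) (there e∈) = Data.Product.map there there (∈-pairUp W El e∈)

  degree≡distinct+repeats : ∀ D y {Nl El} → Dedup (map (opposite y) (edgesAt D y)) Nl El → degree D y ≡ length Nl + length El
  degree≡distinct+repeats D y nbrs = trans (sym (length-map (opposite y) (edgesAt D y))) (sym (Dedup-length nbrs))

  degree-outside : ∀ {S} D v → All (EdgeWithin S) D → v ∉ S → degree D v ≡ 0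
  degree-outside D v D⊆S v∉S = count-none (incident? v) D (All.map (λ { (u∈ , _) (inj₁ refl) → v∉S u∈ ; (_ , w∈) (inj₂ refl) → v∉S w∈ }) D⊆S)

  incident-three : ∀ {p q r} e → Incident p e → Incident q e → Incident r e → p ≡ q ⊎ p ≡ r ⊎ q ≡ r
  incident-three e (inj₁ refl) (inj₁ refl) _ = inj₁ refl
  incident-three e (inj₂ refl) (inj₂ refl) _ = inj₁ refl
  incident-three e (inj₁ refl) (inj₂ refl) (inj₁ refl) = inj₂ (inj₁ refl)
  incident-three e (inj₁ refl) (inj₂ refl) (inj₂ refl) = inj₂ (inj₂ refl)
  incident-three e (inj₂ refl) (inj₁ refl) (inj₁ refl) = inj₂ (inj₂ refl)
  incident-three e (inj₂ refl) (inj₁ refl) (inj₂ refl) = inj₂ (inj₁ refl)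

  degree+degree≤length : ∀ D u v → (∀ e → e ∈ D → Incident u e → Incident v e → ⊥) → degree D u + degree D v ≤ length D
  degree+degree≤length D u v disjoint =
    ≤-trans (count-disjoint (incident? u) (incident? v) (λ e → incident? u e ⊎-dec incident? v e) D disjoint (λ _ _ → inj₁) (λ _ _ → inj₂))
            (length-filter _ D)

  degree+degree≤degree : ∀ D u v w → (∀ e → e ∈ D → Incident u e → Incident v e → ⊥) →
                         (∀ e → e ∈ D → Incident u e → Incident w e) → (∀ e → e ∈ D → Incident v e → Incident w e) →
                         degree D u + degree D v ≤ degree D w
  degree+degree≤degree D u v w = count-disjoint (incident? u) (incident? v) (incident? w) D

  spoke-demands-↭ : ∀ {D y Nl El Hh Rr} → Dedup (map (opposite y) (edgesAt D y)) Nl El → edgesAvoiding D y ↭ Hh ++ Rr →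
                    map (y ,_) Nl ++ (map (y ,_) El ++ (Hh ++ Rr)) ↭ map (y ,_) (map (opposite y) (edgesAt D y)) ++ edgesAvoiding D y
  spoke-demands-↭ {D} {y} {Nl} {El} {Hh} {Rr} nbrs split = begin
    map (y ,_) Nl ++ (map (y ,_) El ++ (Hh ++ Rr)) ≡⟨ ++-assoc (map (y ,_) Nl) _ _ ⟨
    (map (y ,_) Nl ++ map (y ,_) El) ++ (Hh ++ Rr) ≡⟨ cong (_++ _) (map-++ (y ,_) Nl El) ⟨
    map (y ,_) (Nl ++ El) ++ (Hh ++ Rr)            ↭⟨ ++⁺ (map⁺ (y ,_) (Dedup-↭ nbrs)) (↭-sym split) ⟩
    map (y ,_) (map (opposite y) (edgesAt D y)) ++ edgesAvoiding D y ∎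
    where open PermutationReasoning

  module Lifting (y : V) (S : List V) (y∈S : y ∈ S) where

    without-≢ : ∀ {v} → v ∈ without y S → v ≢ y
    without-≢ = proj₂ ∘ ∈-without⁻ {y} {S}

    without-⊆ : ∀ {v} → v ∈ without y S → v ∈ S
    without-⊆ = proj₁ ∘ ∈-without⁻ {y} {S}

    Spoke : V → V × V → Set
    Spoke v e = e ≡ (y , v) ⊎ e ≡ (v , y)

    SameEdge : V × V → V × V → Set
    SameEdge e e' = e' ≡ e ⊎ e' ≡ swap e

    spoke-unique : ∀ {e e' v v'} → SameEdge e e' → Spoke v e → Spoke v' e' → v ≡ v'
    spoke-unique (inj₁ refl) (inj₁ refl) (inj₁ refl) = refl
    spoke-unique (inj₁ refl) (inj₁ refl) (inj₂ refl) = refl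
    spoke-unique (inj₁ refl) (inj₂ refl) (inj₁ refl) = refl
    spoke-unique (inj₁ refl) (inj₂ refl) (inj₂ refl) = refl
    spoke-unique (inj₂ refl) (inj₁ refl) (inj₁ refl) = refl
    spoke-unique (inj₂ refl) (inj₁ refl) (inj₂ refl) = refl
    spoke-unique (inj₂ refl) (inj₂ refl) (inj₁ refl) = refl
    spoke-unique (inj₂ refl) (inj₂ refl) (inj₂ refl) = refl

    spoke-meets-y : ∀ {e e' v} → SameEdge e e' → Spoke v e → proj₁ e' ≢ y → proj₂ e' ≢ y → ⊥
    spoke-meets-y (inj₁ refl) (inj₁ refl) ≢₁ _ = ≢₁ refl
    spoke-meets-y (inj₁ refl) (inj₂ refl) _ ≢₂ = ≢₂ refl
    spoke-meets-y (inj₂ refl) (inj₁ refl) _ ≢₂ = ≢₂ refl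
    spoke-meets-y (inj₂ refl) (inj₂ refl) ≢₁ _ = ≢₁ refl

    SameEdge-sym : ∀ {e e'} → SameEdge e e' → SameEdge e' e
    SameEdge-sym (inj₁ refl) = inj₁ refl
    SameEdge-sym (inj₂ refl) = inj₂ refl

    -- A route of the lifted realization: it uses the spokes y–v for v in spokes, and otherwise only
    -- edges avoiding y of its bases, which are routes of the realization on S ∖ y.
    record Lift : Set where
      constructor lift
      field
        route  : Route
        spokes : List V
        bases  : List Route

    open Lift

    WellLifted : Lift → Set
    WellLifted l = ∀ e → e ∈ routeEdges (route l) →
      (∃ λ v → v ∈ spokes l × Spoke v e) ⊎ (∃ λ r → r ∈ bases l × e ∈ routeEdges r × proj₁ e ≢ y × proj₂ e ≢ y)

    WellLifted-clash : ∀ {l l'} → WellLifted l → WellLifted l' → Disjoint (spokes l) (spokes l') →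
                       (∀ {r r'} → r ∈ bases l → r' ∈ bases l' → EdgeDisjoint r r') →
                       ∀ {e e'} → e ∈ routeEdges (route l) → e' ∈ routeEdges (route l') → SameEdge e e' → ⊥
    WellLifted-clash wl wl' spokes∥ bases∥ e∈ e'∈ same with wl _ e∈ | wl' _ e'∈
    ... | inj₁ (v , v∈ , spoke) | inj₁ (v' , v'∈ , spoke') =
      spokes∥ (v∈ , subst (_∈ _) (sym (spoke-unique same spoke spoke')) v'∈)
    ... | inj₁ (_ , _ , spoke) | inj₂ (_ , _ , _ , ≢₁ , ≢₂) = spoke-meets-y same spoke ≢₁ ≢₂
    ... | inj₂ (_ , _ , _ , ≢₁ , ≢₂) | inj₁ (_ , _ , spoke') = spoke-meets-y (SameEdge-sym same) spoke' ≢₁ ≢₂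
    ... | inj₂ (r , r∈ , e∈r , _) | inj₂ (r' , r'∈ , e'∈r' , _) =
      bases∥ r∈ r'∈ (_ , e∈r , Data.Sum.map (λ { refl → e'∈r' }) (λ { refl → e'∈r' }) same)

    WellLifted-disjoint : ∀ {l l'} → WellLifted l → WellLifted l' → Disjoint (spokes l) (spokes l') →
                          (∀ {r r'} → r ∈ bases l → r' ∈ bases l' → EdgeDisjoint r r') → EdgeDisjoint (route l) (route l')
    WellLifted-disjoint {l} {l'} wl wl' spokes∥ bases∥ (_ , e∈ , inj₁ e∈') = WellLifted-clash {l} {l'} wl wl' spokes∥ bases∥ e∈ e∈' (inj₁ refl)
    WellLifted-disjoint {l} {l'} wl wl' spokes∥ bases∥ (_ , e∈ , inj₂ e∈') = WellLifted-clash {l} {l'} wl wl' spokes∥ bases∥ e∈ e∈' (inj₂ refl)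

    WellLifted-pairwise : ∀ ls → All WellLifted ls → AllPairs EdgeDisjoint (concatMap bases ls) →
                          Unique (concatMap spokes ls) → AllPairs EdgeDisjoint (map route ls)
    WellLifted-pairwise [] _ _ _ = []
    WellLifted-pairwise (l ∷ ls) (wl ∷ wls) bases∥ spokes-unique =
      apart ls wls (AllPairs-++-cross (bases l) bases∥) (λ (v∈ , v∈') → AllPairs-++-cross (spokes l) spokes-unique v∈ v∈' refl)
      ∷ WellLifted-pairwise ls wls (AllPairs-++⁻ʳ (bases l) bases∥) (AllPairs-++⁻ʳ (spokes l) spokes-unique)
      where
      apart : ∀ ls → All WellLifted ls → (∀ {r r'} → r ∈ bases l → r' ∈ concatMap bases ls → EdgeDisjoint r r') →
              Disjoint (spokes l) (concatMap spokes ls) → All (EdgeDisjoint (route l)) (map route ls)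
      apart [] [] _ _ = []
      apart (l' ∷ ls) (wl' ∷ wls) bases∥ spokes∥ =
        WellLifted-disjoint {l} {l'} wl wl' (λ (v∈ , v∈') → spokes∥ (v∈ , ∈-++⁺ˡ v∈')) (λ r∈ r'∈ → bases∥ r∈ (∈-++⁺ˡ r'∈))
        ∷ apart ls wls (λ r∈ r'∈ → bases∥ r∈ (∈-++⁺ʳ (bases l') r'∈)) (λ (v∈ , v∈') → spokes∥ (v∈ , ∈-++⁺ʳ (spokes l') v∈'))

    record LiftedFamily (D : Multigraph N) (spks : List V) (bs : List Route) : Set where
      field
        lifts      : List Lift
        wellLifted : All WellLifted lifts
        demands    : map proj₁ (map route lifts) ≡ D
        spokes≡    : concatMap spokes lifts ≡ spks
        bases≡     : concatMap bases lifts ≡ bs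
        within     : All (RouteWithin S) (map route lifts)

    open LiftedFamily

    ∅ : LiftedFamily [] [] []
    ∅ = record { lifts = [] ; wellLifted = [] ; demands = refl ; spokes≡ = refl ; bases≡ = refl ; within = [] }

    infixr 5 _◁_∣_ _⊕_

    _◁_∣_ : ∀ {D spks bs} (l : Lift) → WellLifted l × RouteWithin S (route l) → LiftedFamily D spks bs →
            LiftedFamily (proj₁ (route l) ∷ D) (spokes l ++ spks) (bases l ++ bs)
    l ◁ (wl , w) ∣ F = record
      { lifts = l ∷ lifts F ; wellLifted = wl ∷ wellLifted F ; demands = cong (_ ∷_) (demands F)
      ; spokes≡ = cong (spokes l ++_) (spokes≡ F) ; bases≡ = cong (bases l ++_) (bases≡ F) ; within = w ∷ within F }

    _⊕_ : ∀ {D₁ D₂ spks₁ spks₂ bs₁ bs₂} → LiftedFamily D₁ spks₁ bs₁ → LiftedFamily D₂ spks₂ bs₂ →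
          LiftedFamily (D₁ ++ D₂) (spks₁ ++ spks₂) (bs₁ ++ bs₂)
    F₁ ⊕ F₂ = record
      { lifts = lifts F₁ ++ lifts F₂
      ; wellLifted = AllP.++⁺ (wellLifted F₁) (wellLifted F₂)
      ; demands = trans (cong (map proj₁) (map-++ route (lifts F₁) (lifts F₂)))
                        (trans (map-++ proj₁ (map route (lifts F₁)) _) (cong₂ _++_ (demands F₁) (demands F₂)))
      ; spokes≡ = trans (concatMap-++ spokes (lifts F₁) (lifts F₂)) (cong₂ _++_ (spokes≡ F₁) (spokes≡ F₂))
      ; bases≡ = trans (concatMap-++ bases (lifts F₁) (lifts F₂)) (cong₂ _++_ (bases≡ F₁) (bases≡ F₂))
      ; within = subst (All (RouteWithin S)) (sym (map-++ route (lifts F₁) (lifts F₂))) (AllP.++⁺ (within F₁) (within F₂))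
      }

    LiftedFamily⇒RealizableWithin : ∀ {D spks bs} → LiftedFamily D spks bs → AllPairs EdgeDisjoint bs → Unique spks →
                                    RealizableWithin S D
    LiftedFamily⇒RealizableWithin F bases∥ spokes-unique =
      map route (lifts F) , demands F ,
      WellLifted-pairwise (lifts F) (wellLifted F) (subst (AllPairs EdgeDisjoint) (sym (bases≡ F)) bases∥)
                                                   (subst Unique (sym (spokes≡ F)) spokes-unique) ,
      within F

    keepFamily : ∀ rs → All (RouteWithin (without y S)) rs → LiftedFamily (map proj₁ rs) [] rs
    keepFamily [] [] = ∅
    keepFamily (r ∷ rs) (r⊆ ∷ rs⊆) = lift r [] (r ∷ []) ◁ (wl , All.map without-⊆ r⊆) ∣ keepFamily rs rs⊆
      where
      wl : WellLifted (lift r [] (r ∷ []))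
      wl e e∈ = let u∈ , v∈ = edge∈vertices (walk (proj₂ r)) e∈ in
        inj₂ (r , here refl , e∈ , without-≢ (All.lookup r⊆ u∈) , without-≢ (All.lookup r⊆ v∈))

    prependSpoke : ∀ {w e} (p : Path (K N) w e) → RouteWithin (without y S) ((w , e) , p) → Path (K N) y e
    prependSpoke p p⊆ = mkPath (y ∷⟨ ≢-sym (without-≢ (All.lookup p⊆ (head∈vertices (walk p)))) ⟩ walk p)
                               (All.map (≢-sym ∘ without-≢) p⊆ ∷ isPath p)

    extendFamily : ∀ rs → All (RouteWithin (without y S)) rs →
                   LiftedFamily (map (λ r → y , proj₂ (proj₁ r)) rs) (map (proj₁ ∘ proj₁) rs) rs
    extendFamily [] [] = ∅
    extendFamily (r@((w , e) , p) ∷ rs) (r⊆ ∷ rs⊆) =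
      lift ((y , e) , prependSpoke p r⊆) (w ∷ []) (r ∷ []) ◁ (wl , y∈S ∷ All.map without-⊆ r⊆) ∣ extendFamily rs rs⊆
      where
      wl : WellLifted (lift ((y , e) , prependSpoke p r⊆) (w ∷ []) (r ∷ []))
      wl _ (here refl) = inj₁ (w , here refl , inj₁ refl)
      wl e' (there e'∈) = let u∈ , v∈ = edge∈vertices (walk p) e'∈ in
        inj₂ (r , here refl , e'∈ , without-≢ (All.lookup r⊆ u∈) , without-≢ (All.lookup r⊆ v∈))

    directFamily : ∀ as → All (λ a → a ≢ y × a ∈ S) as → LiftedFamily (map (y ,_) as) as []
    directFamily [] [] = ∅
    directFamily (a ∷ as) ((a≢y , a∈S) ∷ ok) =
      lift ((y , a) , mkPath (y ∷⟨ ≢-sym a≢y ⟩ [ a ]) ((≢-sym a≢y ∷ []) ∷ [] ∷ [])) (a ∷ []) []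
        ◁ ((λ { _ (here refl) → inj₁ (a , here refl , inj₁ refl) }) , y∈S ∷ a∈S ∷ [])
        ∣ directFamily as ok

    HubEdge : V × V → Set
    HubEdge (b , c) = b ≢ y × c ≢ y × b ≢ c × b ∈ S × c ∈ S

    hubFamily : ∀ H → All HubEdge H → LiftedFamily H (endpoints H) []
    hubFamily [] [] = ∅
    hubFamily ((b , c) ∷ H) ((b≢y , c≢y , b≢c , b∈S , c∈S) ∷ ok) =
      lift ((b , c) , mkPath (b ∷⟨ b≢y ⟩ (y ∷⟨ ≢-sym c≢y ⟩ [ c ])) ((b≢y ∷ b≢c ∷ []) ∷ (≢-sym c≢y ∷ []) ∷ [] ∷ [])) (b ∷ c ∷ []) []
        ◁ ((λ { _ (here refl) → inj₁ (b , here refl , inj₂ refl) ; _ (there (here refl)) → inj₁ (c , there (here refl) , inj₁ refl) })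
          , b∈S ∷ y∈S ∷ c∈S ∷ [])
        ∣ hubFamily H ok

    extendFamily-pairUp : ∀ W El rs → length W ≡ length El → map proj₁ rs ≡ pairUp W El →
                          All (RouteWithin (without y S)) rs → LiftedFamily (map (y ,_) El) W rs
    extendFamily-pairUp W El rs |W| demands rs⊆ = subst₂ (λ D spks → LiftedFamily D spks rs) El≡ W≡ (extendFamily rs rs⊆)
      where
      W≡ : map (proj₁ ∘ proj₁) rs ≡ W
      W≡ = trans (map-∘ {g = proj₁} {f = proj₁} rs) (trans (cong (map proj₁) demands) (map-proj₁-pairUp W El |W|))
      El≡ : map (λ r → y , proj₂ (proj₁ r)) rs ≡ map (y ,_) El
      El≡ = trans (map-∘ {g = y ,_} {f = proj₂ ∘ proj₁} rs)
                       (cong (map (y ,_)) (trans (map-∘ {g = proj₂} {f = proj₁} rs)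
                                          (trans (cong (map proj₂) demands) (map-proj₂-pairUp W El |W|))))

    hub-edges : ∀ {D Hh Rr} → Loopless D → All (EdgeWithin S) D → edgesAvoiding D y ↭ Hh ++ Rr → All HubEdge Hh
    hub-edges {D} loopless D⊆S split = All.tabulate λ h∈ →
      let h∈D , y∉h = ∈-filter⁻ (nonincident? y) {xs = D} (∈-resp-↭ (↭-sym split) (∈-++⁺ˡ h∈))
          b∈S , c∈S = All.lookup D⊆S h∈D in
      (y∉h ∘ inj₁) , (y∉h ∘ inj₂) , All.lookup loopless h∈D , b∈S , c∈S

    lift-realization : ∀ D → Loopless D → All (EdgeWithin S) D →
      ∀ Nl El → Dedup (map (opposite y) (edgesAt D y)) Nl El →
      ∀ Hh Rr → edgesAvoiding D y ↭ Hh ++ Rr →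
      ∀ W → length W ≡ length El → Unique (W ++ Nl ++ endpoints Hh) →
      RealizableWithin (without y S) (Rr ++ pairUp W El) → RealizableWithin S D
    lift-realization D loopless D⊆S Nl El nbrs Hh Rr split W |W| spokes-unique (rs , eq , pairwise , rs⊆)
      with map≡++⇒split proj₁ rs Rr (pairUp W El) eq
    ... | rsR , rsZ , refl , refl , rsZ-demands =
      RealizableWithin-↭ (↭-sym (↭-filter-∁ (incident? y) D))
        (RealizableWithin-reorient (reorient-++ (reorient-edgesAt y (edgesAt D y) (AllP.all-filter (incident? y) D)) (reorient-refl _))
          (RealizableWithin-↭ (spoke-demands-↭ {D} {Hh = Hh} nbrs split) (LiftedFamily⇒RealizableWithin family bases∥ spokes-unique′)))
      where
      family : LiftedFamily (map (y ,_) Nl ++ (map (y ,_) El ++ (Hh ++ map proj₁ rsR))) (Nl ++ (W ++ (endpoints Hh ++ []))) (rsZ ++ rsR)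
      family = directFamily Nl (neighbours-within loopless D⊆S nbrs)
             ⊕ extendFamily-pairUp W El rsZ |W| rsZ-demands (AllP.++⁻ʳ rsR rs⊆)
             ⊕ hubFamily Hh (hub-edges loopless D⊆S split)
             ⊕ keepFamily rsR (AllP.++⁻ˡ rsR rs⊆)
      bases∥ : AllPairs EdgeDisjoint (rsZ ++ rsR)
      bases∥ = AllPairs-EdgeDisjoint-↭ (++-comm rsR rsZ) pairwise
      spokes-unique′ : Unique (Nl ++ (W ++ (endpoints Hh ++ [])))
      spokes-unique′ = subst (λ t → Unique (Nl ++ (W ++ t))) (sym (++-identityʳ (endpoints Hh))) (Unique-↭ (shifts W Nl) spokes-unique)

  Claim : ℕ → Set
  Claim s = ∀ S → length S ≡ s → Unique S → ∀ D → Loopless D → All (EdgeWithin S) D →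
            length D ≤ bound s → (∀ v → degree D v ≤ s ∸ 1) → RealizableWithin S D

  -- Removing y: the demands y–a towards the distinct neighbours a ∈ Nl are served by the spokes y–a, each repeated demand
  -- y–e (e ∈ El) is replaced by a demand w–e from a fresh vertex w ∈ W, and each edge of Hh is routed through y.
  module Reduction {S D} (loopless : Loopless D) (D⊆S : All (EdgeWithin S) D)
                   (y : V) {Nl El} (nbrs : Dedup (map (opposite y) (edgesAt D y)) Nl El)
                   (Hh Rr : Multigraph N) (split : edgesAvoiding D y ↭ Hh ++ Rr)
                   (W : List V) (|W| : length W ≡ length El) (spokes-unique : Unique (W ++ Nl ++ endpoints Hh))
                   (W⊆ : All (_∈ without y S) W) where

    reduced : Multigraph N
    reduced = Rr ++ pairUp W El

    fresh≢repeat : ∀ {w e} → w ∈ W → e ∈ El → w ≢ e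
    fresh≢repeat w∈ e∈ = AllPairs-++-cross W spokes-unique w∈ (∈-++⁺ˡ (All.lookup (Dedup-repeats⊆distinct nbrs) e∈))

    degree-split : ∀ v → degree D v ≡ degree (edgesAt D y) v + degree (edgesAvoiding D y) v
    degree-split v = trans (count-↭ (incident? v) (↭-filter-∁ (incident? y) D)) (count-++ (incident? v) (edgesAt D y) (edgesAvoiding D y))

    degree-edgesAt : ∀ v → v ≢ y → degree (edgesAt D y) v ≡ occ v Nl + occ v El
    degree-edgesAt v v≢y = begin
      degree (edgesAt D y) v                          ≡⟨ degree-reorient v (reorient-edgesAt y (edgesAt D y) (AllP.all-filter (incident? y) D)) ⟨
      degree (map (y ,_) (map (opposite y) (edgesAt D y))) v ≡⟨ degree-spokes y v v≢y (map (opposite y) (edgesAt D y)) ⟩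
      occ v (map (opposite y) (edgesAt D y))          ≡⟨ count-↭ (_≟ v) (Dedup-↭ nbrs) ⟨
      occ v (Nl ++ El)                                ≡⟨ count-++ (_≟ v) Nl El ⟩
      occ v Nl + occ v El                             ∎
      where open ≡-Reasoning

    degree-edgesAvoiding : ∀ v → degree (edgesAvoiding D y) v ≡ degree Hh v + degree Rr v
    degree-edgesAvoiding v = trans (count-↭ (incident? v) split) (count-++ (incident? v) Hh Rr)

    degree-reduced : ∀ v → degree reduced v ≡ degree Rr v + (occ v W + occ v El)
    degree-reduced v = trans (count-++ (incident? v) Rr (pairUp W El)) (cong (degree Rr v +_) (degree-pairUp v W El |W| fresh≢repeat))

    degree-balance : ∀ v → v ≢ y → degree reduced v + occ v Nl + degree Hh v ≡ degree D v + occ v W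
    degree-balance v v≢y rewrite degree-reduced v | degree-split v | degree-edgesAt v v≢y | degree-edgesAvoiding v
      = solve (degree Rr v) (occ v W) (occ v El) (occ v Nl) (degree Hh v)
      where
      solve : ∀ a b c d e → a + (b + c) + d + e ≡ d + c + (e + a) + b
      solve = Data.Nat.Tactic.RingSolver.solve-∀

    length-balance : length reduced + length Nl + length Hh ≡ length D
    length-balance = begin
      length reduced + length Nl + length Hh            ≡⟨ cong (λ m → m + length Nl + length Hh) (length-++ Rr) ⟩
      length Rr + length (pairUp W El) + length Nl + length Hh ≡⟨ cong (λ m → length Rr + m + length Nl + length Hh) (length-pairUp W El |W|) ⟩
      length Rr + length El + length Nl + length Hh     ≡⟨ solve (length Rr) (length El) (length Nl) (length Hh) ⟩
      (length Nl + length El) + (length Hh + length Rr) ≡⟨ cong₂ _+_ (trans (Dedup-length nbrs) (length-map (opposite y) (edgesAt D y)))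
                                                                     (trans (sym (length-++ Hh)) (sym (↭-length split))) ⟩
      length (edgesAt D y) + length (edgesAvoiding D y) ≡⟨ length-++ (edgesAt D y) ⟨
      length (edgesAt D y ++ edgesAvoiding D y)         ≡⟨ ↭-length (↭-filter-∁ (incident? y) D) ⟨
      length D                                          ∎
      where
      open ≡-Reasoning
      solve : ∀ a b c d → a + b + c + d ≡ (c + b) + (d + a)
      solve = Data.Nat.Tactic.RingSolver.solve-∀

    fresh-degree : ∀ {s} v → v ≢ y → v ∈ W → degree D v + 3 ≤ suc s → degree reduced v ≤ s ∸ 1
    fresh-degree {s} v v≢y v∈W =
      fresh-degree-≤∸1 s (degree reduced v) (occ v Nl) (degree Hh v) (degree D v)
        (trans (degree-balance v v≢y) (cong (degree D v +_) (occ≡1 v (AllPairs-++⁻ˡ W spokes-unique) v∈W)))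

    lost-degree : ∀ {s} v → v ≢ y → v ∉ W → 1 ≤ occ v Nl + degree Hh v → degree D v ≤ s → degree reduced v ≤ s ∸ 1
    lost-degree {s} v v≢y v∉W =
      lost-degree-≤∸1 s (degree reduced v) (occ v Nl) (degree Hh v) (degree D v)
        (trans (degree-balance v v≢y) (cong (degree D v +_) (occ≡0 v W v∉W)))

    kept-degree : ∀ {s} v → v ≢ y → v ∉ W → degree D v ≤ s ∸ 1 → degree reduced v ≤ s ∸ 1
    kept-degree {s} v v≢y v∉W =
      kept-degree-≤∸1 s (degree reduced v) (occ v Nl) (degree Hh v) (degree D v)
        (trans (degree-balance v v≢y) (cong (degree D v +_) (occ≡0 v W v∉W)))

    kept-edge : ∀ {e} → e ∈ Rr → e ∈ D × ¬ Incident y e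
    kept-edge e∈ = ∈-filter⁻ (nonincident? y) {xs = D} (∈-resp-↭ (↭-sym split) (∈-++⁺ʳ Hh e∈))

    reduced-loopless : Loopless reduced
    reduced-loopless = All.tabulate λ e∈ →
      [ (λ e∈Rr → All.lookup loopless (proj₁ (kept-edge e∈Rr))) , (λ e∈WE → uncurry fresh≢repeat (∈-pairUp W El e∈WE)) ]′ (∈-++⁻ Rr e∈)

    reduced-within : All (EdgeWithin (without y S)) reduced
    reduced-within = All.tabulate λ e∈ → [ kept , paired ]′ (∈-++⁻ Rr e∈)
      where
      kept : ∀ {e} → e ∈ Rr → EdgeWithin (without y S) e
      kept e∈ = let e∈D , y∉e = kept-edge e∈ ; u∈ , v∈ = All.lookup D⊆S e∈D in
        ∈-without⁺ u∈ (y∉e ∘ inj₁) , ∈-without⁺ v∈ (y∉e ∘ inj₂)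
      paired : ∀ {e} → e ∈ pairUp W El → EdgeWithin (without y S) e
      paired e∈ = let w∈ , e∈El = ∈-pairUp W El e∈
                      e≢y , e∈S = All.lookup (neighbours-within loopless D⊆S nbrs) (All.lookup (Dedup-repeats⊆distinct nbrs) e∈El) in
        All.lookup W⊆ w∈ , ∈-without⁺ e∈S e≢y

    realize : ∀ {s} → Claim s → y ∈ S → Unique S → length S ≡ suc s → length reduced ≤ bound s →
              (∀ v → v ∈ without y S → degree reduced v ≤ s ∸ 1) → RealizableWithin S D
    realize {s} claim y∈S S-unique |S| few-edges low-degree =
      Lifting.lift-realization y S y∈S D loopless D⊆S Nl El nbrs Hh Rr split W |W| spokes-unique
        (claim (without y S) (suc-injective (trans (length-without y S S-unique y∈S) |S|)) (UP.filter⁺ (∁? (_≟ y)) S-unique)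
               reduced reduced-loopless reduced-within few-edges low-degree′)
      where
      low-degree′ : ∀ v → degree reduced v ≤ s ∸ 1
      low-degree′ v with v ∈? without y S
      ... | yes v∈ = low-degree v v∈
      ... | no v∉ = subst (_≤ s ∸ 1) (sym (degree-outside reduced v reduced-within v∉)) z≤n

  module MaxDegree {s S D} (|S| : length S ≡ suc s) (S-unique : Unique S)
                   (loopless : Loopless D) (D⊆S : All (EdgeWithin S) D) (low-degree : ∀ v → degree D v ≤ s)
                   (x : V) (x∈S : x ∈ S) (x-max : ∀ {v} → v ∈ S → degree D v ≤ degree D x)
                   {Nl El} (nbrs : Dedup (map (opposite x) (edgesAt D x)) Nl El) where

    neighbour-ok : ∀ {b} → b ∈ Nl → b ≢ x × b ∈ S
    neighbour-ok = All.lookup (neighbours-within loopless D⊆S nbrs)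

    opposite∈neighbours : ∀ {e} → e ∈ D → Incident x e → opposite x e ∈ Nl
    opposite∈neighbours e∈ x∈e = Dedup-⊆distinct nbrs (∈-map⁺ (opposite x) (∈-filter⁺ (incident? x) e∈ x∈e))

    nonneighbour-nonadjacent : ∀ {v} → v ≢ x → v ∉ Nl → ∀ e → e ∈ D → Incident x e → Incident v e → ⊥
    nonneighbour-nonadjacent v≢x v∉Nl e e∈ x∈e v∈e =
      v∉Nl (subst (_∈ Nl) (opposite-unique x _ e x∈e v∈e v≢x) (opposite∈neighbours e∈ x∈e))

    nonneighbour-double-degree : ∀ {v} → v ∈ S → v ≢ x → v ∉ Nl → degree D v + degree D v ≤ length D
    nonneighbour-double-degree {v} v∈S v≢x v∉Nl = begin
      degree D v + degree D v ≤⟨ +-monoʳ-≤ (degree D v) (x-max v∈S) ⟩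
      degree D v + degree D x ≡⟨ +-comm (degree D v) (degree D x) ⟩
      degree D x + degree D v ≤⟨ degree+degree≤length D x v (nonneighbour-nonadjacent v≢x v∉Nl) ⟩
      length D                ∎
      where open ≤-Reasoning

    three-distinct : ∀ {v a} → v ∈ S → v ≢ x → v ∉ Nl → a ∈ Nl → 3 ≤ suc s
    three-distinct {v} {a} v∈S v≢x v∉Nl a∈Nl = subst (3 ≤_) |S| (Unique-⊆⇒length≤ {xs = x ∷ v ∷ a ∷ []}
      ((≢-sym v≢x ∷ ≢-sym (proj₁ (neighbour-ok a∈Nl)) ∷ []) ∷ (v≢a ∷ []) ∷ [] ∷ [])
      (x∈S ∷ v∈S ∷ proj₂ (neighbour-ok a∈Nl) ∷ []))
      where
      v≢a : v ≢ a
      v≢a refl = v∉Nl a∈Nl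

    nonneighbour-degree : ∀ {v a} → length D ≤ bound (suc s) → v ∈ S → v ≢ x → v ∉ Nl → a ∈ Nl → degree D v ≤ s ∸ 1
    nonneighbour-degree few v∈S v≢x v∉Nl a∈Nl =
      double≤bound⇒≤∸2 (suc s) _ (three-distinct v∈S v≢x v∉Nl a∈Nl) (≤-trans (nonneighbour-double-degree v∈S v≢x v∉Nl) few)

    -- If S = {x, v, a}, every edge at x or at v ends in a, so deg a ≥ deg x + deg v ≥ 2 + deg v; as deg a ≤ s = 2, v is isolated.
    small-isolated : ∀ {v a} → ¬ 4 ≤ suc s → 1 ≤ length El → v ∈ S → v ≢ x → v ∉ Nl → a ∈ Nl → degree D v ≡ 0
    small-isolated {v} {a} 4≰ El≢[] v∈S v≢x v∉Nl a∈Nl with degree D v in deg-v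
    ... | zero = refl
    ... | suc _ = ⊥-elim (4≰ (s≤s (≤-trans 3≤deg-a (low-degree a))))
      where
      a≢x : a ≢ x
      a≢x = proj₁ (neighbour-ok a∈Nl)
      a∈S : a ∈ S
      a∈S = proj₂ (neighbour-ok a∈Nl)
      only-a : ∀ {z} → z ∈ S → z ≢ x → z ≢ v → z ≡ a
      only-a {z} z∈S z≢x z≢v with z ≟ a
      ... | yes z≡a = z≡a
      ... | no z≢a = ⊥-elim (4≰ (subst (4 ≤_) |S| (Unique-⊆⇒length≤ {xs = x ∷ v ∷ a ∷ z ∷ []}
        ((≢-sym v≢x ∷ ≢-sym a≢x ∷ ≢-sym z≢x ∷ []) ∷ ((λ { refl → v∉Nl a∈Nl }) ∷ ≢-sym z≢v ∷ []) ∷ (≢-sym z≢a ∷ []) ∷ [] ∷ [])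
        (x∈S ∷ v∈S ∷ a∈S ∷ z∈S ∷ []))))
      ends-at-a : ∀ {u e} → Incident u e → opposite u e ∈ S → opposite u e ≢ x → opposite u e ≢ v → Incident a e
      ends-at-a {u} {e} _ opp∈S opp≢x opp≢v = subst (λ z → Incident z e) (only-a opp∈S opp≢x opp≢v) (opposite-incident u e)
      x-to-a : ∀ e → e ∈ D → Incident x e → Incident a e
      x-to-a e e∈ x∈e = let b∈Nl = opposite∈neighbours e∈ x∈e in
        ends-at-a x∈e (proj₂ (neighbour-ok b∈Nl)) (proj₁ (neighbour-ok b∈Nl)) (λ b≡v → v∉Nl (subst (_∈ Nl) b≡v b∈Nl))
      v-to-a : ∀ e → e ∈ D → Incident v e → Incident a e
      v-to-a e e∈ v∈e = ends-at-a v∈e (opposite-within v e (All.lookup D⊆S e∈))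
        (λ c≡x → nonneighbour-nonadjacent v≢x v∉Nl e e∈ (subst (λ z → Incident z e) c≡x (opposite-incident v e)) v∈e)
        (opposite-≢ v e (All.lookup loopless e∈) v∈e)
      3≤deg-a : 3 ≤ degree D a
      3≤deg-a = ≤-trans (+-mono-≤ (subst (2 ≤_) (sym (degree≡distinct+repeats D x nbrs)) (+-mono-≤ (length-∈ a∈Nl) El≢[]))
                                  (subst (1 ≤_) (sym deg-v) (s≤s z≤n)))
                        (degree+degree≤degree D x v a (nonneighbour-nonadjacent v≢x v∉Nl) x-to-a v-to-a)

    nonneighbour-slack : ∀ {v a} → length D ≤ bound (suc s) → 1 ≤ length El → v ∈ S → v ≢ x → v ∉ Nl → a ∈ Nl →
                         degree D v + 3 ≤ suc s
    nonneighbour-slack few El≢[] v∈S v≢x v∉Nl a∈Nl with 4 ≤? suc s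
    ... | yes 4≤ = double≤bound⇒+3≤ (suc s) _ 4≤ (≤-trans (nonneighbour-double-degree v∈S v≢x v∉Nl) few)
    ... | no 4≰ = subst (λ d → d + 3 ≤ suc s) (sym (small-isolated 4≰ El≢[] v∈S v≢x v∉Nl a∈Nl)) (three-distinct v∈S v≢x v∉Nl a∈Nl)

    caseFewEdges : Claim s → ∀ {a} → a ∈ Nl → length D ≤ bound (suc s) → length D ≤ length Nl + bound s → RealizableWithin S D
    caseFewEdges claim {a} a∈Nl few fewer = R.realize claim x∈S S-unique |S| reduced-few degree-ok
      where
      T : List V
      T = x ∷ Nl
      W : List V
      W = fresh T S (length El)
      room : length El + length T ≤ length S
      room = begin
        length El + suc (length Nl) ≡⟨ +-suc (length El) (length Nl) ⟩
        suc (length El + length Nl) ≡⟨ cong suc (+-comm (length El) (length Nl)) ⟩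
        suc (length Nl + length El) ≡⟨ cong suc (degree≡distinct+repeats D x nbrs) ⟨
        suc (degree D x)            ≤⟨ s≤s (low-degree x) ⟩
        suc s                       ≡⟨ |S| ⟨
        length S                    ∎
        where open ≤-Reasoning
      |W| : length W ≡ length El
      |W| = length-fresh T S (length El) S-unique room
      module R = Reduction loopless D⊆S x nbrs [] (edgesAvoiding D x) ↭-refl W |W|
        (fresh-++-unique {T} {S} {length El} S-unique (subst Unique (sym (++-identityʳ Nl)) (Dedup-unique nbrs))
                                  (All.tabulate (there ∘ subst (_ ∈_) (++-identityʳ Nl))))
        (fresh⊆without {x} {T} {S} {length El} (here refl))
      reduced-few : length R.reduced ≤ bound s
      reduced-few = +-cancelʳ-≤ (length Nl) _ _ (begin
        length R.reduced + length Nl ≡⟨ trans (sym (+-identityʳ _)) R.length-balance ⟩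
        length D                     ≤⟨ fewer ⟩
        length Nl + bound s          ≡⟨ +-comm (length Nl) (bound s) ⟩
        bound s + length Nl          ∎)
        where open ≤-Reasoning
      degree-ok : ∀ v → v ∈ without x S → degree R.reduced v ≤ s ∸ 1
      degree-ok v v∈ with ∈-without⁻ v∈ | v ∈? W | v ∈? Nl
      ... | v∈S , v≢x | yes v∈W | _ =
        R.fresh-degree {s} v v≢x v∈W (nonneighbour-slack few (≤-trans (length-∈ v∈W) (≤-reflexive |W|)) v∈S v≢x
                                                          (proj₂ (∈-fresh⁻ T S _ v∈W) ∘ there) a∈Nl)
      ... | _ , v≢x | no v∉W | yes v∈Nl = R.lost-degree {s} v v≢x v∉W (≤-trans (count-∈ (_≟ v) Nl v∈Nl refl) (m≤m+n _ _)) (low-degree v)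
      ... | v∈S , v≢x | no v∉W | no v∉Nl = R.kept-degree {s} v v≢x v∉W (nonneighbour-degree few v∈S v≢x v∉Nl a∈Nl)

  module SingleNeighbour {t S D} (|S| : length S ≡ 5 + t) (S-unique : Unique S)
                         (loopless : Loopless D) (D⊆S : All (EdgeWithin S) D)
                         (|D| : length D ≡ 5 + (t + t)) (low-degree : ∀ v → degree D v ≤ 4 + t)
                         (x : V) (x∈S : x ∈ S) (x-max : ∀ {v} → v ∈ S → degree D v ≤ degree D x)
                         {a El} (nbrs : Dedup (map (opposite x) (edgesAt D x)) (a ∷ []) El) where

    open MaxDegree |S| S-unique loopless D⊆S low-degree x x∈S x-max nbrs
      using (neighbour-ok; opposite∈neighbours; nonneighbour-double-degree)

    a≢x : a ≢ x
    a≢x = proj₁ (neighbour-ok (here refl))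

    x-edge-at-a : ∀ e → e ∈ D → Incident x e → Incident a e
    x-edge-at-a e e∈ x∈e with opposite∈neighbours e∈ x∈e
    ... | here opp≡a = subst (λ z → Incident z e) opp≡a (opposite-incident x e)

    -- Every edge at x meets a and deg a ≤ deg x, so the edges at a are exactly those at x.
    a-edge-at-x : ∀ e → e ∈ D → Incident a e → Incident x e
    a-edge-at-x = count-mono-tight (incident? x) (incident? a) D x-edge-at-a (x-max (proj₂ (neighbour-ok (here refl))))

    third-avoids : ∀ {v} → v ≢ x → v ≢ a → ∀ e → Incident x e → Incident a e → ¬ Incident v e
    third-avoids v≢x v≢a e x∈e a∈e v∈e with incident-three e x∈e a∈e v∈e
    ... | inj₁ x≡a = a≢x (sym x≡a)
    ... | inj₂ (inj₁ x≡v) = v≢x (sym x≡v)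
    ... | inj₂ (inj₂ a≡v) = v≢a (sym a≡v)

    third-slack : ∀ {v} → v ∈ S → v ≢ x → v ≢ a → degree D v + 3 ≤ 5 + t
    third-slack v∈S v≢x v≢a = double≤bound⇒+3≤ (5 + t) _ (s≤s (s≤s (s≤s (s≤s z≤n))))
      (≤-trans (nonneighbour-double-degree v∈S v≢x λ { (here v≡a) → v≢a v≡a }) (≤-reflexive (trans |D| (sym (bound-5+ t)))))

    -- Remove a vertex y ∉ {x, a} that has an edge, routing one edge h = x–a through y.
    module AtThird {y} (y∈S : y ∈ S) (y≢x : y ≢ x) (y≢a : y ≢ a) {e₁} (e₁∈ : e₁ ∈ D) (y∈e₁ : Incident y e₁)
                   {Nly Ely} (nbrs-y : Dedup (map (opposite y) (edgesAt D y)) Nly Ely)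
                   {h} (h∈ : h ∈ D) (x∈h : Incident x h) {as bs} (h-split : edgesAvoiding D y ≡ as ++ h ∷ bs) where

      a∈h : Incident a h
      a∈h = x-edge-at-a h h∈ x∈h

      endpoint-incident : ∀ {q} → q ∈ proj₁ h ∷ proj₂ h ∷ [] → Incident q h
      endpoint-incident (here refl) = inj₁ refl
      endpoint-incident (there (here refl)) = inj₂ refl

      h-endpoint : ∀ {q} → q ∈ proj₁ h ∷ proj₂ h ∷ [] → q ≡ x ⊎ q ≡ a
      h-endpoint q∈ with incident-three h x∈h a∈h (endpoint-incident q∈)
      ... | inj₁ x≡a = ⊥-elim (a≢x (sym x≡a))
      ... | inj₂ (inj₁ x≡q) = inj₁ (sym x≡q)
      ... | inj₂ (inj₂ a≡q) = inj₂ (sym a≡q)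

      neighbour-y-avoids : ∀ {b} → b ∈ Nly → b ≢ x × b ≢ a
      neighbour-y-avoids b∈ with ∈-map⁻ (opposite y) (Dedup-distinct⊆ nbrs-y b∈)
      ... | e , e∈ , refl = (λ b≡x → third-avoids y≢x y≢a e (at b≡x) (x-edge-at-a e e∈D (at b≡x)) y∈e) ,
                            (λ b≡a → third-avoids y≢x y≢a e (a-edge-at-x e e∈D (at b≡a)) (at b≡a) y∈e)
        where
        e∈D : e ∈ D
        e∈D = proj₁ (∈-filter⁻ (incident? y) {xs = D} e∈)
        y∈e : Incident y e
        y∈e = proj₂ (∈-filter⁻ (incident? y) {xs = D} e∈)
        at : ∀ {z} → opposite y e ≡ z → Incident z e
        at refl = opposite-incident y e

      T : List V
      T = y ∷ x ∷ a ∷ Nly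

      W : List V
      W = fresh T S (length Ely)

      room : length Ely + length T ≤ length S
      room = begin
        length Ely + (3 + length Nly) ≡⟨ solve (length Ely) (length Nly) ⟩
        length Nly + length Ely + 3   ≡⟨ cong (_+ 3) (degree≡distinct+repeats D y nbrs-y) ⟨
        degree D y + 3                ≤⟨ third-slack y∈S y≢x y≢a ⟩
        5 + t                         ≡⟨ |S| ⟨
        length S                      ∎
        where
        open ≤-Reasoning
        solve : ∀ m n → m + (3 + n) ≡ n + m + 3
        solve = Data.Nat.Tactic.RingSolver.solve-∀

      spokes-unique : Unique (W ++ Nly ++ endpoints (h ∷ []))
      spokes-unique = fresh-++-unique {T} {S} {length Ely} S-unique
        (UP.++⁺ (Dedup-unique nbrs-y) ((All.lookup loopless h∈ ∷ []) ∷ [] ∷ [])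
                (λ (b∈ , q∈) → [ proj₁ (neighbour-y-avoids b∈) , proj₂ (neighbour-y-avoids b∈) ]′ (h-endpoint q∈)))
        (All.tabulate λ v∈ → [ there ∘ there ∘ there , [ there ∘ here , there ∘ there ∘ here ]′ ∘ h-endpoint ]′ (∈-++⁻ Nly v∈))

      split : edgesAvoiding D y ↭ (h ∷ []) ++ (as ++ bs)
      split = subst (_↭ h ∷ as ++ bs) (sym h-split) (shift h as bs)

      module R = Reduction loopless D⊆S y nbrs-y (h ∷ []) (as ++ bs) split W (length-fresh T S (length Ely) S-unique room)
                           spokes-unique (fresh⊆without {y} {T} {S} {length Ely} (here refl))

      reduced-few : length R.reduced ≤ bound (4 + t)
      reduced-few = reduced-length-≤bound t _ (length Nly) (trans R.length-balance |D|)
        (length-∈ (Dedup-⊆distinct nbrs-y (∈-map⁺ (opposite y) (∈-filter⁺ (incident? y) e₁∈ y∈e₁))))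

      degree-ok : ∀ v → v ∈ without y S → degree R.reduced v ≤ (4 + t) ∸ 1
      degree-ok v v∈ with ∈-without⁻ v∈ | v ∈? W
      ... | v∈S , v≢y | yes v∈W = R.fresh-degree {4 + t} v v≢y v∈W (third-slack v∈S (v∉T ∘ there ∘ here) (v∉T ∘ there ∘ there ∘ here))
        where
        v∉T : v ∉ T
        v∉T = proj₂ (∈-fresh⁻ T S _ v∈W)
      ... | v∈S , v≢y | no v∉W with v ≟ x | v ≟ a
      ...   | yes refl | _ = R.lost-degree {4 + t} v v≢y v∉W (≤-trans (count-∈ (incident? v) (h ∷ []) (here refl) x∈h) (m≤n+m _ _)) (low-degree v)
      ...   | no _ | yes refl = R.lost-degree {4 + t} v v≢y v∉W (≤-trans (count-∈ (incident? v) (h ∷ []) (here refl) a∈h) (m≤n+m _ _)) (low-degree v)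
      ...   | no v≢x | no v≢a = R.kept-degree {4 + t} v v≢y v∉W (+3≤⇒≤∸1 (4 + t) _ (third-slack v∈S v≢x v≢a))

      realize : Claim (4 + t) → RealizableWithin S D
      realize claim = R.realize claim y∈S S-unique |S| reduced-few degree-ok

    via-third : Claim (4 + t) → ∀ {y e₁} → e₁ ∈ D → Incident y e₁ → y ∈ S → y ≢ x → y ≢ a →
                ∀ {h} → h ∈ D → Incident x h → RealizableWithin S D
    via-third claim {y} e₁∈ y∈e₁ y∈S y≢x y≢a {h} h∈ x∈h
      with dedup (map (opposite y) (edgesAt D y))
         | ∈-∃++ (∈-filter⁺ (nonincident? y) h∈ (third-avoids y≢x y≢a h x∈h (x-edge-at-a h h∈ x∈h)))
    ... | Nly , Ely , nbrs-y | as , bs , h-split = AtThird.realize y∈S y≢x y≢a e₁∈ y∈e₁ nbrs-y h∈ x∈h h-split claim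

    caseSingleNeighbour : Claim (4 + t) → RealizableWithin S D
    caseSingleNeighbour claim
      with count<length⇒∃∁ (incident? a) D (subst (degree D a <_) (sym |D|) (≤4+⇒<5+double t _ (low-degree a)))
         | count>0⇒∃ (incident? x) D (subst (1 ≤_) (sym (degree≡distinct+repeats D x nbrs)) (s≤s z≤n))
    ... | (y , z) , e₁∈ , a∉e₁ | h , h∈ , x∈h = via-third claim e₁∈ (inj₁ refl) (proj₁ (All.lookup D⊆S e₁∈)) y≢x y≢a h∈ x∈h
      where
      y≢x : y ≢ x
      y≢x y≡x = a∉e₁ (x-edge-at-a (y , z) e₁∈ (inj₁ y≡x))
      y≢a : y ≢ a
      y≢a = a∉e₁ ∘ inj₁

  inductionStep : ∀ {s} → Claim s → ∀ S → length S ≡ suc s → Unique S → ∀ D → Loopless D → All (EdgeWithin S) D →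
                  length D ≤ bound (suc s) → (∀ v → degree D v ≤ s) → ∀ {e₀} → e₀ ∈ D → RealizableWithin S D
  inductionStep {s} claim S |S| S-unique D loopless D⊆S few low-degree {e₀} e₀∈
    with argmax (degree D) (proj₁ e₀) S
  ... | x , x∈ , e₀≤x , x-max
    with x∈S ← [ (λ { refl → proj₁ (All.lookup D⊆S e₀∈) }) , id ]′ x∈
       | dedup (map (opposite x) (edgesAt D x))
  ... | [] , [] , nbrs = contradiction (≤-trans (≤-trans (count-∈ (incident? _) D e₀∈ (inj₁ refl)) e₀≤x)
                                                (≤-reflexive (degree≡distinct+repeats D x nbrs))) λ ()
  ... | [] , _ ∷ _ , nbrs with () ∷ _ ← Dedup-repeats⊆distinct nbrs
  ... | a ∷ Nl , El , nbrs with length D ≤? length (a ∷ Nl) + bound s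
  ...   | yes fewer = MaxDegree.caseFewEdges |S| S-unique loopless D⊆S low-degree x x∈S x-max nbrs claim (here refl) few fewer
  ...   | no more with bound-exceeded⇒tight s (length D) (length (a ∷ Nl)) few more (s≤s z≤n)
  ...     | t , refl , single , |D| with Nl
  ...       | [] = SingleNeighbour.caseSingleNeighbour |S| S-unique loopless D⊆S |D| low-degree x x∈S x-max nbrs claim
  ...       | _ ∷ _ = contradiction single λ ()

  claim : ∀ s → Claim s
  claim s S _ _ [] _ _ _ _ = [] , refl , [] , []
  claim zero [] _ _ (e ∷ D) _ ((() , _) ∷ _) _ _
  claim zero (_ ∷ _) () _ (_ ∷ _) _ _ _ _
  claim (suc s) S |S| S-unique D@(_ ∷ _) loopless D⊆S few low-degree =
    inductionStep (claim s) S |S| S-unique D loopless D⊆S few low-degree (here refl)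

mainTheorem11 : (n : ℕ) (D : Multigraph n) →
    Loopless D →
    length D ≤ 2 * n ∸ 5 →
    (∀ v → degree D v ≤ n ∸ 1) →
    Realizable (K n) D
mainTheorem11 n D loopless few low-degree =
  Routing.RealizableWithin⇒Realizable (K n)
    (claim n n (allFin n) (length-tabulate id) (UP.allFin⁺ n) D loopless
           (All.tabulate λ {e} _ → ∈-allFin (proj₁ e) , ∈-allFin (proj₂ e))
           (≤-trans few (m≤n⊔m 3 (2 * n ∸ 5))) low-degree)
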